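{- Let $p$ be a prime. For all integers $n,m,k\geq 0$, $$A_{n+pm+k,\,k}\equiv A_{n+m+k,\,m+k}\pmod p.$$
   Context: A partition of a finite set is a collection of nonempty, pairwise disjoint subsets (blocks) whose union is the set; a singleton of a partition is a block with exactly one element. For integers $0\leq k\leq n$, $A_{n,k}$ denotes the number of partitions of $\{1,2,\dots,n+1\}$ whose largest singleton is $k+1$ (i.e. $\{k+1\}$ is a block and no $j>k+1$ forms a singleton block). -}

module Defs where

open import Data.Nat using (ℕ; zero; suc; _<_)
open import Data.Nat.Properties using (_<?_)
open import Data.Fin using (Fin; toℕ)
open import Data.Fin.Subset using (Subset; ⁅_⁆; _∈_; _∩_; Nonempty; Empty; outside; inside)
open import Data.Fin.Subset.Properties using (_∈?_)
open import Data.Fin.Properties using (any?; all?)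
open import Data.List using (List; []; _∷_; map; _++_; length; filter)
open import Data.List.Relation.Unary.All using (All) renaming (all? to allL?)
open import Data.List.Relation.Unary.Any using (Any) renaming (any? to anyL?)
open import Data.List.Relation.Unary.AllPairs using (AllPairs)
import Data.List.Relation.Unary.AllPairs as AP
import Data.List.Membership.DecPropositional as DM
open import Data.List.Membership.Propositional using () renaming (_∈_ to _∈L_; _∉_ to _∉L_)
open import Data.Vec using (_∷_; [])
open import Data.Vec.Properties using (≡-dec)
open import Data.Bool.Properties using () renaming (_≟_ to _≟ᵇ_)
open import Data.Product using (_×_; ∃; _,_)
open import Relation.Nullary using (Dec; ¬_; yes; no)
open import Relation.Nullary.Decidable using (_×-dec_; ¬?; _→-dec_)
open import Relation.Binary.PropositionalEquality using (_≡_)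

allSubsets : (n : ℕ) → List (Subset n)
allSubsets zero = [] ∷ []
allSubsets (suc n) = map (outside ∷_) (allSubsets n) ++ map (inside ∷_) (allSubsets n)

-- All sublists of a list (each sub-collection exactly once, if the list has no duplicates).
sublists : ∀ {a} {A : Set a} → List A → List (List A)
sublists [] = [] ∷ []
sublists (x ∷ xs) = sublists xs ++ map (x ∷_) (sublists xs)

Disjoint : ∀ {N} → Subset N → Subset N → Set
Disjoint p q = Empty (p ∩ q)

IsPartition : ∀ {N} → List (Subset N) → Set
IsPartition {N} F = All Nonempty F × AllPairs Disjoint F × (∀ (x : Fin N) → Any (x ∈_) F)

-- The element x (of Fin N, standing for the integer toℕ x + 1 of {1,…,N}) forms a singleton block of F.
IsSingletonOf : ∀ {N} → List (Subset N) → Fin N → Set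
IsSingletonOf F x = ⁅ x ⁆ ∈L F

LargestSingletonIs : ∀ {N} → List (Subset N) → ℕ → Set
LargestSingletonIs {N} F k =
  (∃ λ (x : Fin N) → toℕ x ≡ k × IsSingletonOf F x) ×
  (∀ (j : Fin N) → k < toℕ j → ¬ IsSingletonOf F j)

private
  nonempty? : ∀ {N} (p : Subset N) → Dec (Nonempty p)
  nonempty? p = any? (λ x → x ∈? p)

  empty? : ∀ {N} (p : Subset N) → Dec (Empty p)
  empty? p = ¬? (nonempty? p)

  memL? : ∀ {N} (s : Subset N) (F : List (Subset N)) → Dec (s ∈L F)
  memL? {N} = DM._∈?_ (≡-dec {n = N} _≟ᵇ_)

isPartition? : ∀ {N} (F : List (Subset N)) → Dec (IsPartition F)
isPartition? F =
  allL? nonempty? F ×-dec (AP.allPairs? (λ p q → empty? (p ∩ q)) F ×-dec all? (λ x → anyL? (x ∈?_) F))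

largestSingletonIs? : ∀ {N} (F : List (Subset N)) (k : ℕ) → Dec (LargestSingletonIs F k)
largestSingletonIs? F k =
  any? (λ x → (toℕ x Data.Nat.≟ k) ×-dec memL? ⁅ x ⁆ F)
  ×-dec all? (λ j → (k <? toℕ j) →-dec (¬? (memL? ⁅ j ⁆ F)))
  where open import Data.Nat using (_≟_)

-- A n k = number of partitions of {1,…,n+1} (modelled as Fin (suc n)) whose largest
-- singleton is k+1 (modelled as the element of Fin (suc n) with toℕ equal to k).
A : ℕ → ℕ → ℕ
A n k = length (filter (λ F → isPartition? F ×-dec largestSingletonIs? F k) (sublists (allSubsets (suc n))))

-- Write W d k for A (k + d) k.  Building a partition element by element while a
-- labelled, possibly empty, sets are still open gives W d k = (𝓜ᵏ U_d)(0), where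
-- (𝓜 f)(a) = f (a + 1) + a f(a) (a free element opens a new set or joins one of the a
-- open ones), U₀ = 1, and U_{d+1} = 𝓜 U_d - U_d (a non-singleton is a free element that
-- is not a singleton).  Hence W d (k + 1) = W (d + 1) k + W d k is a Pascal recurrence,
-- and modulo p,  W d (p + k) ≡ W (p + d) k + W d k.  On the other hand
-- (𝓜ᵖ g)(0) = Σᵢ S(p,i) g(i) with S(p,i) ≡ [i = 1] for i < p (compare y ^ p ≡ y in the
-- falling-factorial basis), and U_d is p-periodic modulo p; this gives Touchard's
-- congruence W d (p + k) ≡ W d (k + 1) + W d k.  So W (p + d) k ≡ W d (k + 1), and m
-- iterations turn A (n + pm + k) k = W (pm + n) k into W n (m + k) = A (n + m + k) (m + k).

module Submission where

open import Data.Nat.Base using (ℕ)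
open import Data.Nat.Primality using (Prime)

module Sequences where

  open import Function.Base using (_∘_)
  open import Data.Nat.Base as ℕ using (zero; suc; _<_; _≤_; z≤n; s≤s)
  import Data.Nat.Properties as ℕ
  open import Data.Nat.Combinatorics using (_C_; k>n⇒nCk≡0; nC1≡n; nCk+nC[k+1]≡[n+1]C[k+1])
  open import Data.Nat.Combinatorics.Base using (_P′_)
  open import Data.Integer.Base using (ℤ; +_; _+_; _*_; _-_; _^_)
  import Data.Integer.Properties as ℤ
  open import Data.Integer.Tactic.RingSolver using (solve-∀)
  import Data.Nat.Tactic.RingSolver as ℕ-Solver
  open import Relation.Binary.PropositionalEquality
  open import Relation.Nullary.Decidable using (yes; no)
  open import Data.Sum.Base using (inj₁; inj₂)
  open ≡-Reasoning

  ∑ : ℕ → (ℕ → ℤ) → ℤ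
  ∑ zero    f = + 0
  ∑ (suc n) f = f 0 + ∑ n (f ∘ suc)

  ∑-cong : ∀ n {f g} → f ≗ g → ∑ n f ≡ ∑ n g
  ∑-cong zero    f≗g = refl
  ∑-cong (suc n) f≗g = cong₂ _+_ (f≗g 0) (∑-cong n (f≗g ∘ suc))

  ∑-zero : ∀ n {f} → f ≗ (λ _ → + 0) → ∑ n f ≡ + 0
  ∑-zero zero    f≗0 = refl
  ∑-zero (suc n) f≗0 = cong₂ _+_ (f≗0 0) (∑-zero n (f≗0 ∘ suc))

  ∑-last : ∀ n f → ∑ (suc n) f ≡ ∑ n f + f n
  ∑-last zero    f = ℤ.+-comm (f 0) (+ 0)
  ∑-last (suc n) f = begin
    f 0 + ∑ (suc n) (f ∘ suc)        ≡⟨ cong (_+_ (f 0)) (∑-last n (f ∘ suc)) ⟩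
    f 0 + (∑ n (f ∘ suc) + f (suc n)) ≡⟨ ℤ.+-assoc (f 0) _ _ ⟨
    ∑ (suc n) f + f (suc n)           ∎

  ∑-extend : ∀ n {f} → f n ≡ + 0 → ∑ (suc n) f ≡ ∑ n f
  ∑-extend n {f} fn≡0 = trans (∑-last n f) (trans (cong (_+_ (∑ n f)) fn≡0) (ℤ.+-identityʳ _))

  ∑-+ : ∀ n f g → ∑ n (λ i → f i + g i) ≡ ∑ n f + ∑ n g
  ∑-+ zero    f g = refl
  ∑-+ (suc n) f g = trans (cong (_+_ (f 0 + g 0)) (∑-+ n (f ∘ suc) (g ∘ suc))) (shuffle (f 0) (g 0) _ _)
    where shuffle : ∀ a b c d → (a + b) + (c + d) ≡ (a + c) + (b + d)
          shuffle = solve-∀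

  ∑-shift : ∀ n f → f 0 ≡ + 0 → f (suc n) ≡ + 0 → ∑ (suc n) f ≡ ∑ (suc n) (f ∘ suc)
  ∑-shift n f f0≡0 fn≡0 = begin
    f 0 + ∑ n (f ∘ suc)  ≡⟨ cong (_+ ∑ n (f ∘ suc)) f0≡0 ⟩
    + 0 + ∑ n (f ∘ suc)  ≡⟨ ℤ.+-identityˡ _ ⟩
    ∑ n (f ∘ suc)        ≡⟨ ∑-extend n fn≡0 ⟨
    ∑ (suc n) (f ∘ suc)  ∎

  ∑-truncate : ∀ {m n} f → m ≤ n → (∀ i → m ≤ i → f i ≡ + 0) → ∑ n f ≡ ∑ m f
  ∑-truncate {n = zero}  f z≤n _ = refl
  ∑-truncate {m} {suc n} f m≤1+n vanish with ℕ.m≤n⇒m<n∨m≡n m≤1+n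
  ... | inj₁ (s≤s m≤n) = trans (∑-extend n (vanish n m≤n)) (∑-truncate f m≤n vanish)
  ... | inj₂ refl      = refl

  δ₁ : ℕ → ℤ
  δ₁ 1 = + 1
  δ₁ _ = + 0

  ∑-δ₁ : ∀ {n} (g : ℕ → ℤ) → 1 < n → ∑ n (λ i → δ₁ i * g i) ≡ g 1
  ∑-δ₁ {suc (suc n)} g (s≤s (s≤s z≤n)) = begin
    + 0 + (+ 1 * g 1 + ∑ n (λ _ → + 0)) ≡⟨ cong (λ s → + 0 + (+ 1 * g 1 + s)) (∑-zero n (λ _ → refl)) ⟩
    + 0 + (+ 1 * g 1 + + 0)             ≡⟨ simplify (g 1) ⟩
    g 1                                 ∎
    where simplify : ∀ x → + 0 + (+ 1 * x + + 0) ≡ x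
          simplify = solve-∀

  𝓜 : (ℕ → ℤ) → ℕ → ℤ
  𝓜 f a = f (suc a) + + a * f a

  𝓜^ : ℕ → (ℕ → ℤ) → ℕ → ℤ
  𝓜^ zero    f = f
  𝓜^ (suc k) f = 𝓜 (𝓜^ k f)

  𝓜-cong : ∀ {f g} → f ≗ g → 𝓜 f ≗ 𝓜 g
  𝓜-cong f≗g a = cong₂ _+_ (f≗g (suc a)) (cong (+ a *_) (f≗g a))

  𝓜^-cong : ∀ k {f g} → f ≗ g → 𝓜^ k f ≗ 𝓜^ k g
  𝓜^-cong zero    f≗g = f≗g
  𝓜^-cong (suc k) f≗g = 𝓜-cong (𝓜^-cong k f≗g)

  𝓜^-suc : ∀ k f → 𝓜^ k (𝓜 f) ≗ 𝓜^ (suc k) f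
  𝓜^-suc zero    f = λ _ → refl
  𝓜^-suc (suc k) f = 𝓜-cong (𝓜^-suc k f)

  𝓜^-+ : ∀ j k f → 𝓜^ (j ℕ.+ k) f ≗ 𝓜^ j (𝓜^ k f)
  𝓜^-+ zero    k f = λ _ → refl
  𝓜^-+ (suc j) k f = 𝓜-cong (𝓜^-+ j k f)

  𝓜^-additive : ∀ k f g → 𝓜^ k (λ a → f a + g a) ≗ λ a → 𝓜^ k f a + 𝓜^ k g a
  𝓜^-additive zero    f g a = refl
  𝓜^-additive (suc k) f g a = trans (𝓜-cong (𝓜^-additive k f g) a) (distrib (+ a) (𝓜^ k f (suc a)) (𝓜^ k g (suc a)) (𝓜^ k f a) (𝓜^ k g a))
    where distrib : ∀ a u v w z → (u + v) + a * (w + z) ≡ (u + a * w) + (v + a * z)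
          distrib = solve-∀

  S₂ : ℕ → ℕ → ℕ
  S₂ zero    zero    = 1
  S₂ zero    (suc i) = 0
  S₂ (suc n) zero    = 0
  S₂ (suc n) (suc i) = suc i ℕ.* S₂ n (suc i) ℕ.+ S₂ n i

  i>n⇒S₂[n,i]≡0 : ∀ {n i} → n < i → S₂ n i ≡ 0
  i>n⇒S₂[n,i]≡0 {zero}  {suc i} _         = refl
  i>n⇒S₂[n,i]≡0 {suc n} {suc i} (s≤s n<i) = begin
    suc i ℕ.* S₂ n (suc i) ℕ.+ S₂ n i
      ≡⟨ cong₂ (λ a b → suc i ℕ.* a ℕ.+ b) (i>n⇒S₂[n,i]≡0 (ℕ.m<n⇒m<1+n n<i)) (i>n⇒S₂[n,i]≡0 n<i) ⟩
    suc i ℕ.* 0 ℕ.+ 0                  ≡⟨ cong (ℕ._+ 0) (ℕ.*-zeroʳ (suc i)) ⟩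
    0                                  ∎

  S₂[n,n]≡1 : ∀ n → S₂ n n ≡ 1
  S₂[n,n]≡1 zero    = refl
  S₂[n,n]≡1 (suc n) = begin
    suc n ℕ.* S₂ n (suc n) ℕ.+ S₂ n n  ≡⟨ cong₂ (λ a b → suc n ℕ.* a ℕ.+ b) (i>n⇒S₂[n,i]≡0 (ℕ.n<1+n n)) (S₂[n,n]≡1 n) ⟩
    suc n ℕ.* 0 ℕ.+ 1                  ≡⟨ cong (ℕ._+ 1) (ℕ.*-zeroʳ (suc n)) ⟩
    1                                  ∎

  𝓜^-stirling : ∀ n g → 𝓜^ n g 0 ≡ ∑ (suc n) (λ i → + S₂ n i * g i)
  𝓜^-stirling zero    g = unit (g 0)
    where unit : ∀ x → x ≡ + 1 * x + + 0
          unit = solve-∀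
  𝓜^-stirling (suc n) g = begin
    𝓜^ (suc n) g 0                                  ≡⟨ 𝓜^-suc n g 0 ⟨
    𝓜^ n (𝓜 g) 0                                    ≡⟨ 𝓜^-stirling n (𝓜 g) ⟩
    ∑ (suc n) (λ i → + S₂ n i * 𝓜 g i)               ≡⟨ ∑-cong (suc n) split ⟩
    ∑ (suc n) (λ i → u i + t i)                      ≡⟨ ∑-+ (suc n) u t ⟩
    ∑ (suc n) u + ∑ (suc n) t                        ≡⟨ cong (_+_ (∑ (suc n) u)) t-shift ⟩
    ∑ (suc n) u + ∑ (suc n) (t ∘ suc)                ≡⟨ ∑-+ (suc n) u (t ∘ suc) ⟨
    ∑ (suc n) (λ i → u i + t (suc i))                ≡⟨ ∑-cong (suc n) recurrence ⟩
    ∑ (suc n) (λ i → + S₂ (suc n) (suc i) * g (suc i)) ≡⟨ ℤ.+-identityˡ _ ⟨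
    ∑ (suc (suc n)) (λ i → + S₂ (suc n) i * g i)     ∎
    where
    u t : ℕ → ℤ
    u i = + S₂ n i * g (suc i)
    t i = + i * (+ S₂ n i * g i)
    split : ∀ i → + S₂ n i * 𝓜 g i ≡ u i + t i
    split i = distrib (+ S₂ n i) (g (suc i)) (+ i) (g i)
      where distrib : ∀ s a b c → s * (a + b * c) ≡ s * a + b * (s * c)
            distrib = solve-∀
    t-shift : ∑ (suc n) t ≡ ∑ (suc n) (t ∘ suc)
    t-shift = ∑-shift n t refl (begin
      + suc n * (+ S₂ n (suc n) * g (suc n)) ≡⟨ cong (λ s → + suc n * (+ s * g (suc n))) (i>n⇒S₂[n,i]≡0 (ℕ.n<1+n n)) ⟩
      + suc n * + 0                          ≡⟨ ℤ.*-zeroʳ (+ suc n) ⟩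
      + 0                                    ∎)
    recurrence : ∀ i → u i + t (suc i) ≡ + S₂ (suc n) (suc i) * g (suc i)
    recurrence i = begin
      + S₂ n i * g (suc i) + + suc i * (+ S₂ n (suc i) * g (suc i)) ≡⟨ collect (+ S₂ n i) (+ suc i) (+ S₂ n (suc i)) (g (suc i)) ⟩
      (+ suc i * + S₂ n (suc i) + + S₂ n i) * g (suc i)
        ≡⟨ cong (λ s → (s + + S₂ n i) * g (suc i)) (ℤ.pos-* (suc i) (S₂ n (suc i))) ⟨
      (+ (suc i ℕ.* S₂ n (suc i)) + + S₂ n i) * g (suc i)
        ≡⟨ cong (_* g (suc i)) (ℤ.pos-+ (suc i ℕ.* S₂ n (suc i)) (S₂ n i)) ⟨
      + S₂ (suc n) (suc i) * g (suc i)                              ∎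
      where collect : ∀ s₀ k s₁ a → s₀ * a + k * (s₁ * a) ≡ (k * s₁ + s₀) * a
            collect = solve-∀

  P′-vanishes : ∀ {y a} → y < a → y P′ a ≡ 0
  P′-vanishes {y} {suc a} (s≤s y≤a) with ℕ.m≤n⇒m<n∨m≡n y≤a
  ... | inj₁ y<a  = trans (cong ((y ℕ.∸ a) ℕ.*_) (P′-vanishes y<a)) (ℕ.*-zeroʳ (y ℕ.∸ a))
  ... | inj₂ refl = cong (ℕ._* (y P′ y)) (ℕ.n∸n≡0 y)

  𝓜-P′ : ∀ y → 𝓜 (λ i → + (y P′ i)) ≗ λ a → + y * + (y P′ a)
  𝓜-P′ y a = begin
    + ((y ℕ.∸ a) ℕ.* (y P′ a)) + + a * + (y P′ a) ≡⟨ cong (_+_ (+ ((y ℕ.∸ a) ℕ.* (y P′ a)))) (ℤ.pos-* a (y P′ a)) ⟨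
    + ((y ℕ.∸ a) ℕ.* (y P′ a)) + + (a ℕ.* (y P′ a)) ≡⟨ ℤ.pos-+ _ (a ℕ.* (y P′ a)) ⟨
    + ((y ℕ.∸ a) ℕ.* (y P′ a) ℕ.+ a ℕ.* (y P′ a))  ≡⟨ cong +_ (ℕ.*-distribʳ-+ (y P′ a) (y ℕ.∸ a) a) ⟨
    + ((y ℕ.∸ a ℕ.+ a) ℕ.* (y P′ a))             ≡⟨ cong +_ step ⟩
    + (y ℕ.* (y P′ a))                           ≡⟨ ℤ.pos-* y (y P′ a) ⟩
    + y * + (y P′ a)                           ∎
    where
    step : (y ℕ.∸ a ℕ.+ a) ℕ.* (y P′ a) ≡ y ℕ.* (y P′ a)
    step with a ℕ.≤? y
    ... | yes a≤y = cong (ℕ._* (y P′ a)) (ℕ.m∸n+n≡m a≤y)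
    ... | no  a≰y rewrite P′-vanishes (ℕ.≰⇒> a≰y) = trans (ℕ.*-zeroʳ (y ℕ.∸ a ℕ.+ a)) (sym (ℕ.*-zeroʳ y))

  𝓜^-P′ : ∀ n y → 𝓜^ n (λ i → + (y P′ i)) ≗ λ a → (+ y) ^ n * + (y P′ a)
  𝓜^-P′ zero    y a = sym (ℤ.*-identityˡ _)
  𝓜^-P′ (suc n) y a = begin
    𝓜 (𝓜^ n (λ i → + (y P′ i))) a                     ≡⟨ 𝓜-cong (𝓜^-P′ n y) a ⟩
    (+ y) ^ n * + (y P′ suc a) + + a * ((+ y) ^ n * + (y P′ a)) ≡⟨ factor ((+ y) ^ n) (+ (y P′ suc a)) (+ a) (+ (y P′ a)) ⟩
    (+ y) ^ n * 𝓜 (λ i → + (y P′ i)) a                  ≡⟨ cong ((+ y) ^ n *_) (𝓜-P′ y a) ⟩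
    (+ y) ^ n * (+ y * + (y P′ a))                       ≡⟨ reassoc ((+ y) ^ n) (+ y) (+ (y P′ a)) ⟩
    (+ y) ^ suc n * + (y P′ a)                           ∎
    where
    factor : ∀ c u a v → c * u + a * (c * v) ≡ c * (u + a * v)
    factor = solve-∀
    reassoc : ∀ c y v → c * (y * v) ≡ (y * c) * v
    reassoc = solve-∀

  power-stirling : ∀ n y → (+ y) ^ n ≡ ∑ (suc n) (λ i → + S₂ n i * + (y P′ i))
  power-stirling n y = begin
    (+ y) ^ n              ≡⟨ ℤ.*-identityʳ _ ⟨
    (+ y) ^ n * + 1         ≡⟨ 𝓜^-P′ n y 0 ⟨
    𝓜^ n (λ i → + (y P′ i)) 0 ≡⟨ 𝓜^-stirling n _ ⟩
    ∑ (suc n) (λ i → + S₂ n i * + (y P′ i)) ∎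

  0^n≡0 : ∀ {n} → 0 < n → (+ 0) ^ n ≡ + 0
  0^n≡0 {suc n} _ = refl

  [k+1]*nC[k+1]≡n*[n-1]Ck : ∀ n k → suc k ℕ.* (n C suc k) ≡ n ℕ.* (ℕ.pred n C k)
  [k+1]*nC[k+1]≡n*[n-1]Ck zero          k       = ℕ.*-zeroʳ (suc k)
  [k+1]*nC[k+1]≡n*[n-1]Ck (suc zero)    zero    = refl
  [k+1]*nC[k+1]≡n*[n-1]Ck (suc zero)    (suc k) = ℕ.*-zeroʳ (suc (suc k))
  [k+1]*nC[k+1]≡n*[n-1]Ck (suc (suc n)) zero    = trans (ℕ.*-identityˡ _) (trans (nC1≡n (suc (suc n))) (sym (ℕ.*-identityʳ _)))
  [k+1]*nC[k+1]≡n*[n-1]Ck (suc (suc n)) (suc k) = begin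
    suc (suc k) ℕ.* (2+n C suc (suc k))
      ≡⟨ cong (suc (suc k) ℕ.*_) (nCk+nC[k+1]≡[n+1]C[k+1] (suc n) (suc k)) ⟨
    suc (suc k) ℕ.* (1+n C suc k ℕ.+ 1+n C suc (suc k))               ≡⟨ expand (suc k) (1+n C suc k) (1+n C suc (suc k)) ⟩
    suc k ℕ.* (1+n C suc k) ℕ.+ 1+n C suc k ℕ.+ suc (suc k) ℕ.* (1+n C suc (suc k))
      ≡⟨ cong₂ (λ a b → a ℕ.+ 1+n C suc k ℕ.+ b) ([k+1]*nC[k+1]≡n*[n-1]Ck (suc n) k) ([k+1]*nC[k+1]≡n*[n-1]Ck (suc n) (suc k)) ⟩
    suc n ℕ.* (n C k) ℕ.+ 1+n C suc k ℕ.+ suc n ℕ.* (n C suc k)       ≡⟨ collect (suc n) (n C k) (1+n C suc k) (n C suc k) ⟩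
    suc n ℕ.* (n C k ℕ.+ n C suc k) ℕ.+ 1+n C suc k
      ≡⟨ cong (λ c → suc n ℕ.* c ℕ.+ 1+n C suc k) (nCk+nC[k+1]≡[n+1]C[k+1] n k) ⟩
    suc n ℕ.* (1+n C suc k) ℕ.+ 1+n C suc k                           ≡⟨ ℕ.+-comm (suc n ℕ.* (1+n C suc k)) _ ⟩
    suc (suc n) ℕ.* (1+n C suc k)                                     ∎
    where
    1+n 2+n : ℕ
    1+n = suc n
    2+n = suc (suc n)
    expand : ∀ k a b → suc k ℕ.* (a ℕ.+ b) ≡ k ℕ.* a ℕ.+ a ℕ.+ suc k ℕ.* b
    expand = ℕ-Solver.solve-∀
    collect : ∀ m a b c → m ℕ.* a ℕ.+ b ℕ.+ m ℕ.* c ≡ m ℕ.* (a ℕ.+ c) ℕ.+ b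
    collect = ℕ-Solver.solve-∀

  module PascalArray (X : ℕ → ℕ → ℤ) (pascal : ∀ d k → X d (suc k) ≡ X (suc d) k + X d k) where

    binomial-expansion : ∀ j d k → X d (j ℕ.+ k) ≡ ∑ (suc j) (λ i → + (j C i) * X (i ℕ.+ d) k)
    binomial-expansion zero    d k = unit (X d k)
      where unit : ∀ x → x ≡ + 1 * x + + 0
            unit = solve-∀
    binomial-expansion (suc j) d k = begin
      X d (suc j ℕ.+ k)                          ≡⟨ pascal d (j ℕ.+ k) ⟩
      X (suc d) (j ℕ.+ k) + X d (j ℕ.+ k)        ≡⟨ cong₂ _+_ (binomial-expansion j (suc d) k) (binomial-expansion j d k) ⟩
      ∑ (suc j) a + (b 0 + ∑ j (b ∘ suc))         ≡⟨ cong (λ s → ∑ (suc j) a + (b 0 + s)) (∑-extend j b[1+j]≡0) ⟨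
      ∑ (suc j) a + (b 0 + ∑ (suc j) (b ∘ suc))   ≡⟨ swap (∑ (suc j) a) (b 0) _ ⟩
      b 0 + (∑ (suc j) a + ∑ (suc j) (b ∘ suc))   ≡⟨ cong (_+_ (b 0)) (∑-+ (suc j) a (b ∘ suc)) ⟨
      b 0 + ∑ (suc j) (λ i → a i + b (suc i))     ≡⟨ cong (_+_ (b 0)) (∑-cong (suc j) pascal-coefficient) ⟩
      ∑ (suc (suc j)) (λ i → + (suc j C i) * X (i ℕ.+ d) k) ∎
      where
      a b : ℕ → ℤ
      a i = + (j C i) * X (i ℕ.+ suc d) k
      b i = + (j C i) * X (i ℕ.+ d) k
      b[1+j]≡0 : b (suc j) ≡ + 0
      b[1+j]≡0 = cong (λ c → + c * X (suc j ℕ.+ d) k) (k>n⇒nCk≡0 (ℕ.n<1+n j))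
      swap : ∀ x y z → x + (y + z) ≡ y + (x + z)
      swap = solve-∀
      pascal-coefficient : ∀ i → a i + b (suc i) ≡ + (suc j C suc i) * X (suc i ℕ.+ d) k
      pascal-coefficient i = begin
        + (j C i) * X (i ℕ.+ suc d) k + b (suc i)                  ≡⟨ cong (λ e → + (j C i) * X e k + b (suc i)) (ℕ.+-suc i d) ⟩
        + (j C i) * X (suc i ℕ.+ d) k + b (suc i)
          ≡⟨ ℤ.*-distribʳ-+ (X (suc i ℕ.+ d) k) (+ (j C i)) (+ (j C suc i)) ⟨
        (+ (j C i) + + (j C suc i)) * X (suc i ℕ.+ d) k            ≡⟨ cong (_* X (suc i ℕ.+ d) k) (ℤ.pos-+ (j C i) (j C suc i)) ⟨
        + (j C i ℕ.+ j C suc i) * X (suc i ℕ.+ d) k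
          ≡⟨ cong (λ c → + c * X (suc i ℕ.+ d) k) (nCk+nC[k+1]≡[n+1]C[k+1] j i) ⟩
        + (suc j C suc i) * X (suc i ℕ.+ d) k                      ∎

  U : ℕ → ℕ → ℤ
  U zero    a = + 1
  U (suc d) a = 𝓜 (U d) a - U d a

  W : ℕ → ℕ → ℤ
  W d k = 𝓜^ k (U d) 0

  W-pascal : ∀ d k → W d (suc k) ≡ W (suc d) k + W d k
  W-pascal d k = begin
    𝓜^ (suc k) (U d) 0                         ≡⟨ 𝓜^-suc k (U d) 0 ⟨
    𝓜^ k (𝓜 (U d)) 0                           ≡⟨ 𝓜^-cong k 𝓜U≡U+U 0 ⟩
    𝓜^ k (λ a → U (suc d) a + U d a) 0          ≡⟨ 𝓜^-additive k (U (suc d)) (U d) 0 ⟩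
    W (suc d) k + W d k                        ∎
    where
    𝓜U≡U+U : 𝓜 (U d) ≗ λ a → U (suc d) a + U d a
    𝓜U≡U+U a = cancel (𝓜 (U d) a) (U d a)
      where cancel : ∀ x y → x ≡ (x - y) + y
            cancel = solve-∀


module Congruence (p : ℕ) where

  open Sequences using (∑; ∑-zero)
  open import Function.Base using (_∘_)
  open import Data.Nat.Base as ℕ using (zero; suc; _<_; z≤n; s≤s)
  open import Data.Nat.Divisibility using () renaming (_∣_ to _∣ℕ_)
  open import Data.Integer.Base using (ℤ; +_; _+_; _*_; -_; _-_)
  import Data.Integer.Properties as ℤ
  open import Data.Integer.Divisibility.Signed
    using (_∣_; divides; ∣ᵤ⇒∣; ∣m∣n⇒∣m+n; ∣m⇒∣-m; ∣n⇒∣m*n; ∣m⇒∣m*n)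
  open import Data.Integer.Tactic.RingSolver using (solve-∀)
  open import Level using (0ℓ)
  open import Relation.Binary.Bundles using (Setoid)
  open import Relation.Binary.PropositionalEquality
  import Relation.Binary.Reasoning.Setoid

  infix 4 _≈_
  record _≈_ (x y : ℤ) : Set where
    constructor mod-p
    field p∣x-y : + p ∣ x - y

  private
    mod-p-by : ∀ {x y u} → + p ∣ u → u ≡ x - y → x ≈ y
    mod-p-by p∣u refl = mod-p p∣u

  ∣⇒≈0 : ∀ {x} → + p ∣ x → x ≈ + 0
  ∣⇒≈0 {x} p∣x = mod-p-by p∣x (sym (ℤ.+-identityʳ x))

  ≈-reflexive : ∀ {x y} → x ≡ y → x ≈ y
  ≈-reflexive {x} refl = mod-p (divides (+ 0) (ℤ.+-inverseʳ x))

  ≈-sym : ∀ {x y} → x ≈ y → y ≈ x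
  ≈-sym {x} {y} (mod-p p∣x-y) = mod-p-by (∣m⇒∣-m p∣x-y) (negate x y)
    where negate : ∀ x y → - (x - y) ≡ y - x
          negate = solve-∀

  ≈-trans : ∀ {x y z} → x ≈ y → y ≈ z → x ≈ z
  ≈-trans {x} {y} {z} (mod-p p∣x-y) (mod-p p∣y-z) = mod-p-by (∣m∣n⇒∣m+n p∣x-y p∣y-z) (telescope x y z)
    where telescope : ∀ x y z → (x - y) + (y - z) ≡ x - z
          telescope = solve-∀

  ≈-setoid : Setoid 0ℓ 0ℓ
  ≈-setoid = record
    { Carrier       = ℤ
    ; _≈_           = _≈_
    ; isEquivalence = record { refl = ≈-reflexive refl ; sym = ≈-sym ; trans = ≈-trans }
    }

  module ≈-Reasoning = Relation.Binary.Reasoning.Setoid ≈-setoid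

  +-cong : ∀ {x x′ y y′} → x ≈ x′ → y ≈ y′ → x + y ≈ x′ + y′
  +-cong {x} {x′} {y} {y′} (mod-p p∣x-x′) (mod-p p∣y-y′) = mod-p-by (∣m∣n⇒∣m+n p∣x-x′ p∣y-y′) (regroup x x′ y y′)
    where regroup : ∀ x x′ y y′ → (x - x′) + (y - y′) ≡ (x + y) - (x′ + y′)
          regroup = solve-∀

  -‿cong : ∀ {x y} → x ≈ y → - x ≈ - y
  -‿cong {x} {y} (mod-p p∣x-y) = mod-p-by (∣m⇒∣-m p∣x-y) (negate x y)
    where negate : ∀ x y → - (x - y) ≡ - x - - y
          negate = solve-∀

  *-congˡ : ∀ c {x y} → x ≈ y → c * x ≈ c * y
  *-congˡ c {x} {y} (mod-p p∣x-y) = mod-p-by (∣n⇒∣m*n c p∣x-y) (distrib c x y)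
    where distrib : ∀ c x y → c * (x - y) ≡ c * x - c * y
          distrib = solve-∀

  *-congʳ : ∀ c {x y} → x ≈ y → x * c ≈ y * c
  *-congʳ c {x} {y} x≈y = ≈-trans (≈-reflexive (ℤ.*-comm x c)) (≈-trans (*-congˡ c x≈y) (≈-reflexive (ℤ.*-comm c y)))

  +-cancelʳ : ∀ {x y} z → x + z ≈ y + z → x ≈ y
  +-cancelʳ {x} {y} z x+z≈y+z = begin
    x             ≡⟨ cancel x z ⟩
    (x + z) - z   ≈⟨ +-cong x+z≈y+z (≈-reflexive {x = - z} refl) ⟩
    (y + z) - z   ≡⟨ cancel y z ⟨
    y             ∎
    where
    open ≈-Reasoning
    cancel : ∀ x z → x ≡ (x + z) - z
    cancel = solve-∀

  +-cancelˡ : ∀ z {x y} → z + x ≈ z + y → x ≈ y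
  +-cancelˡ z {x} {y} z+x≈z+y = +-cancelʳ z (≈-trans (≈-reflexive (ℤ.+-comm x z)) (≈-trans z+x≈z+y (≈-reflexive (ℤ.+-comm z y))))

  multiple≈0 : ∀ {m} → p ∣ℕ m → ∀ x → + m * x ≈ + 0
  multiple≈0 {m} p∣m x = ∣⇒≈0 (∣m⇒∣m*n x (∣ᵤ⇒∣ {+ p} {+ m} p∣m))

  ∑-cong-≈ : ∀ n {f g} → (∀ i → i < n → f i ≈ g i) → ∑ n f ≈ ∑ n g
  ∑-cong-≈ zero    f≈g = ≈-reflexive refl
  ∑-cong-≈ (suc n) f≈g = +-cong (f≈g 0 (s≤s z≤n)) (∑-cong-≈ n (λ i i<n → f≈g (suc i) (s≤s i<n)))

  ∑-≈-head : ∀ {n} f → 0 < n → (∀ i → 0 < i → i < n → f i ≈ + 0) → ∑ n f ≈ f 0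
  ∑-≈-head {suc n} f _ f≈0 = begin
    f 0 + ∑ n (f ∘ suc)        ≈⟨ +-cong (≈-reflexive {f 0} refl) (∑-cong-≈ n (λ i i<n → f≈0 (suc i) (s≤s z≤n) (s≤s i<n))) ⟩
    f 0 + ∑ n (λ _ → + 0)      ≡⟨ cong (_+_ (f 0)) (∑-zero n (λ _ → refl)) ⟩
    f 0 + + 0                  ≡⟨ ℤ.+-identityʳ (f 0) ⟩
    f 0                        ∎
    where open ≈-Reasoning


module ModuloPrime {p : ℕ} (p-prime : Prime p) where

  open Sequences
  open Congruence p
  open import Data.Nat.Base as ℕ using (zero; suc; _<_; _≤_; z≤n; s≤s)
  import Data.Nat.Properties as ℕ
  open import Data.Nat.Divisibility as ℕ using (divides) renaming (_∣_ to _∣ℕ_)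
  open import Data.Nat.Combinatorics using (_C_; nCn≡1)
  open import Data.Nat.Combinatorics.Base using (_P′_)
  open import Data.Nat.Primality using (euclidsLemma; prime⇒nonTrivial)
  open import Data.Integer.Base using (ℤ; +_; _+_; _*_; _-_; _^_; ∣_∣)
  import Data.Integer.Properties as ℤ
  open import Data.Integer.Divisibility.Signed using (_∣_; ∣ᵤ⇒∣; ∣⇒∣ᵤ)
  open import Data.Integer.Tactic.RingSolver using (solve-∀)
  open import Data.Sum.Base using (inj₁; inj₂)
  open import Data.Empty using (⊥-elim)
  open import Relation.Nullary.Negation using (¬_)
  open import Relation.Binary.PropositionalEquality

  *-cancelʳ : ∀ {x y m} → ¬ p ∣ℕ m → x * + m ≈ y * + m → x ≈ y
  *-cancelʳ {x} {y} {m} p∤m (mod-p p∣xm-ym)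
    with euclidsLemma ∣ x - y ∣ m p-prime (subst (p ∣ℕ_) (ℤ.abs-* (x - y) (+ m)) (∣⇒∣ᵤ p∣[x-y]m))
    where
    factor : ∀ x y m → x * m - y * m ≡ (x - y) * m
    factor = solve-∀
    p∣[x-y]m : + p ∣ (x - y) * + m
    p∣[x-y]m = subst (+ p ∣_) (factor x y (+ m)) p∣xm-ym
  ... | inj₁ p∣x-y = mod-p (∣ᵤ⇒∣ p∣x-y)
  ... | inj₂ p∣m   = ⊥-elim (p∤m p∣m)

  1<p : 1 < p
  1<p = ℕ.nonTrivial⇒n>1 p {{prime⇒nonTrivial p-prime}}

  0<m<p⇒p∤m : ∀ {m} → 0 < m → m < p → ¬ p ∣ℕ m
  0<m<p⇒p∤m {suc m} _ m<p p∣m = ℕ.<⇒≱ m<p (ℕ.∣⇒≤ p∣m)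

  p∣pCk : ∀ {k} → 0 < k → k < p → p ∣ℕ p C k
  p∣pCk {suc k} _ k<p with euclidsLemma (suc k) (p C suc k) p-prime p∣[k+1]*pCk
    where
    p∣[k+1]*pCk : p ∣ℕ suc k ℕ.* (p C suc k)
    p∣[k+1]*pCk = divides (ℕ.pred p C k) (trans ([k+1]*nC[k+1]≡n*[n-1]Ck p k) (ℕ.*-comm p _))
  ... | inj₁ p∣k+1 = ⊥-elim (0<m<p⇒p∤m (s≤s z≤n) k<p p∣k+1)
  ... | inj₂ p∣C    = p∣C

  p∤P′ : ∀ {j i} → j < p → i ≤ j → ¬ p ∣ℕ j P′ i
  p∤P′ {j} {zero}  j<p _   = 0<m<p⇒p∤m (s≤s z≤n) 1<p
  p∤P′ {j} {suc i} j<p i<j p∣P′ with euclidsLemma (j ℕ.∸ i) (j P′ i) p-prime p∣P′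
  ... | inj₁ p∣j-i = 0<m<p⇒p∤m (ℕ.m<n⇒0<n∸m i<j) (ℕ.≤-<-trans (ℕ.m∸n≤m j i) j<p) p∣j-i
  ... | inj₂ p∣P′ᵢ = p∤P′ j<p (ℕ.<⇒≤ i<j) p∣P′ᵢ

  binomial-mod-p : (X : ℕ → ℕ → ℤ) → (∀ d k → X d (suc k) ≡ X (suc d) k + X d k) →
                   ∀ d k → X d (p ℕ.+ k) ≈ X (p ℕ.+ d) k + X d k
  binomial-mod-p X pascal d k = begin
    X d (p ℕ.+ k)                ≡⟨ binomial-expansion p d k ⟩
    ∑ (suc p) f                  ≡⟨ ∑-last p f ⟩
    ∑ p f + f p                  ≈⟨ +-cong (∑-≈-head f (ℕ.<-trans (s≤s z≤n) 1<p) middle≈0) (≈-reflexive f[p]≡X) ⟩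
    f 0 + X (p ℕ.+ d) k          ≡⟨ ℤ.+-comm (f 0) _ ⟩
    X (p ℕ.+ d) k + + 1 * X d k  ≡⟨ cong (_+_ (X (p ℕ.+ d) k)) (ℤ.*-identityˡ (X d k)) ⟩
    X (p ℕ.+ d) k + X d k        ∎
    where
    open PascalArray X pascal
    open ≈-Reasoning
    f : ℕ → ℤ
    f i = + (p C i) * X (i ℕ.+ d) k
    middle≈0 : ∀ i → 0 < i → i < p → f i ≈ + 0
    middle≈0 i 0<i i<p = multiple≈0 (p∣pCk 0<i i<p) (X (i ℕ.+ d) k)
    f[p]≡X : f p ≡ X (p ℕ.+ d) k
    f[p]≡X = trans (cong (λ c → + c * X (p ℕ.+ d) k) (nCn≡1 p)) (ℤ.*-identityˡ _)

  fermat : ∀ y → (+ y) ^ p ≈ + y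
  fermat zero    = ≈-reflexive (0^n≡0 (ℕ.<-trans (s≤s z≤n) 1<p))
  fermat (suc y) = begin
    (+ suc y) ^ p                       ≡⟨ ℤ.*-identityˡ _ ⟨
    X 0 p                               ≡⟨ cong (X 0) (ℕ.+-identityʳ p) ⟨
    X 0 (p ℕ.+ 0)                       ≈⟨ binomial-mod-p X pascal 0 0 ⟩
    X (p ℕ.+ 0) 0 + X 0 0               ≡⟨ cong (λ e → X e 0 + + 1) (ℕ.+-identityʳ p) ⟩
    (+ y) ^ p * + 1 + + 1               ≡⟨ cong (_+ + 1) (ℤ.*-identityʳ ((+ y) ^ p)) ⟩
    (+ y) ^ p + + 1                     ≈⟨ +-cong (fermat y) (≈-reflexive refl) ⟩
    + y + + 1                           ≡⟨ ℤ.+-comm (+ y) (+ 1) ⟩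
    + suc y                             ∎
    where
    open ≈-Reasoning
    X : ℕ → ℕ → ℤ
    X d k = (+ y) ^ d * (+ suc y) ^ k
    pascal : ∀ d k → X d (suc k) ≡ X (suc d) k + X d k
    pascal d k = expand (+ y) ((+ y) ^ d) ((+ suc y) ^ k)
      where expand : ∀ y a b → a * ((+ 1 + y) * b) ≡ (y * a) * b + a * b
            expand = solve-∀

  falling-factorial-coefficients : ∀ n (a b : ℕ → ℤ) →
    (∀ y → ∑ (suc n) (λ i → a i * + (y P′ i)) ≈ ∑ (suc n) (λ i → b i * + (y P′ i))) →
    ∀ i → i ≤ n → i < p → a i ≈ b i
  falling-factorial-coefficients n a b same i i≤n i<p = agree (suc i) (s≤s i≤n) i<p i (ℕ.n<1+n i)
    where
    terms : (ℕ → ℤ) → ℕ → ℕ → ℤ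
    terms c y i = c i * + (y P′ i)

    truncate : ∀ {j} c → j ≤ n → ∑ (suc n) (terms c j) ≡ ∑ j (terms c j) + terms c j j
    truncate {j} c j≤n = trans (∑-truncate (terms c j) (s≤s j≤n) vanish) (∑-last j (terms c j))
      where
      vanish : ∀ i → suc j ≤ i → terms c j i ≡ + 0
      vanish i j<i = trans (cong (λ x → c i * + x) (P′-vanishes j<i)) (ℤ.*-zeroʳ (c i))

    -- Evaluating at y = j kills all terms beyond j, and j P′ j = j! is a unit modulo p.
    leading : ∀ j → j ≤ n → j < p → (∀ i → i < j → a i ≈ b i) → a j ≈ b j
    leading j j≤n j<p lower = *-cancelʳ (p∤P′ j<p ℕ.≤-refl) (+-cancelˡ (∑ j (terms a j)) (begin
      ∑ j (terms a j) + terms a j j    ≡⟨ truncate a j≤n ⟨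
      ∑ (suc n) (terms a j)            ≈⟨ same j ⟩
      ∑ (suc n) (terms b j)            ≡⟨ truncate b j≤n ⟩
      ∑ j (terms b j) + terms b j j    ≈⟨ +-cong (∑-cong-≈ j (λ i i<j → *-congʳ _ (≈-sym (lower i i<j)))) (≈-reflexive refl) ⟩
      ∑ j (terms a j) + terms b j j    ∎))
      where open ≈-Reasoning

    agree : ∀ j → j ≤ suc n → j ≤ p → ∀ i → i < j → a i ≈ b i
    agree (suc j) (s≤s j≤n) j<p i (s≤s i≤j) with ℕ.m≤n⇒m<n∨m≡n i≤j
    ... | inj₁ i<j  = agree j (ℕ.m≤n⇒m≤1+n j≤n) (ℕ.<⇒≤ j<p) i i<j
    ... | inj₂ refl = leading i j≤n j<p (agree i (ℕ.m≤n⇒m≤1+n j≤n) (ℕ.<⇒≤ j<p))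

  S₂[p,i]≈δ₁ : ∀ i → i < p → + S₂ p i ≈ δ₁ i
  S₂[p,i]≈δ₁ i i<p = falling-factorial-coefficients p (λ i → + S₂ p i) δ₁ both-expand-y i (ℕ.<⇒≤ i<p) i<p
    where
    both-expand-y : ∀ y → ∑ (suc p) (λ i → + S₂ p i * + (y P′ i)) ≈ ∑ (suc p) (λ i → δ₁ i * + (y P′ i))
    both-expand-y y = begin
      ∑ (suc p) (λ i → + S₂ p i * + (y P′ i))  ≡⟨ power-stirling p y ⟨
      (+ y) ^ p                               ≈⟨ fermat y ⟩
      + y                                     ≡⟨ cong +_ (ℕ.*-identityʳ y) ⟨
      + (y P′ 1)                              ≡⟨ ∑-δ₁ (λ i → + (y P′ i)) (s≤s (ℕ.<⇒≤ 1<p)) ⟨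
      ∑ (suc p) (λ i → δ₁ i * + (y P′ i))      ∎
      where open ≈-Reasoning

  touchard : ∀ g → 𝓜^ p g 0 ≈ g 1 + g p
  touchard g = begin
    𝓜^ p g 0                        ≡⟨ 𝓜^-stirling p g ⟩
    ∑ (suc p) (λ i → + S₂ p i * g i) ≡⟨ ∑-last p _ ⟩
    ∑ p (λ i → + S₂ p i * g i) + + S₂ p p * g p
      ≈⟨ +-cong (∑-cong-≈ p (λ i i<p → *-congʳ (g i) (S₂[p,i]≈δ₁ i i<p))) (≈-reflexive S₂[p,p]*g[p]≡g[p]) ⟩
    ∑ p (λ i → δ₁ i * g i) + g p      ≡⟨ cong (_+ g p) (∑-δ₁ g 1<p) ⟩
    g 1 + g p                        ∎
    where
    open ≈-Reasoning
    S₂[p,p]*g[p]≡g[p] : + S₂ p p * g p ≡ g p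
    S₂[p,p]*g[p]≡g[p] = trans (cong (λ s → + s * g p) (S₂[n,n]≡1 p)) (ℤ.*-identityˡ (g p))

  Periodic : (ℕ → ℤ) → Set
  Periodic f = ∀ a → f (a ℕ.+ p) ≈ f a

  𝓜-periodic : ∀ {f} → Periodic f → Periodic (𝓜 f)
  𝓜-periodic {f} f-periodic a = begin
    f (suc a ℕ.+ p) + + (a ℕ.+ p) * f (a ℕ.+ p)               ≡⟨ cong (λ c → f (suc a ℕ.+ p) + c * f (a ℕ.+ p)) (ℤ.pos-+ a p) ⟩
    f (suc a ℕ.+ p) + (+ a + + p) * f (a ℕ.+ p)               ≡⟨ distrib (f (suc a ℕ.+ p)) (+ a) (+ p) (f (a ℕ.+ p)) ⟩
    (f (suc a ℕ.+ p) + + a * f (a ℕ.+ p)) + + p * f (a ℕ.+ p)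
      ≈⟨ +-cong (+-cong (f-periodic (suc a)) (*-congˡ (+ a) (f-periodic a))) (multiple≈0 (ℕ.∣-refl {p}) (f (a ℕ.+ p))) ⟩
    𝓜 f a + + 0                                               ≡⟨ ℤ.+-identityʳ (𝓜 f a) ⟩
    𝓜 f a                                                     ∎
    where
    open ≈-Reasoning
    distrib : ∀ u a q v → u + (a + q) * v ≡ (u + a * v) + q * v
    distrib = solve-∀

  𝓜^-periodic : ∀ k {f} → Periodic f → Periodic (𝓜^ k f)
  𝓜^-periodic zero    f-periodic = f-periodic
  𝓜^-periodic (suc k) f-periodic = 𝓜-periodic (𝓜^-periodic k f-periodic)

  U-periodic : ∀ d → Periodic (U d)
  U-periodic zero    a = ≈-reflexive refl
  U-periodic (suc d) a = +-cong (𝓜-periodic (U-periodic d) a) (-‿cong (U-periodic d a))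

  W-touchard : ∀ d k → W d (p ℕ.+ k) ≈ W d (suc k) + W d k
  W-touchard d k = begin
    𝓜^ (p ℕ.+ k) (U d) 0     ≡⟨ 𝓜^-+ p k (U d) 0 ⟩
    𝓜^ p g 0                 ≈⟨ touchard g ⟩
    g 1 + g p                ≈⟨ +-cong (≈-reflexive (sym (ℤ.+-identityʳ (g 1)))) (𝓜^-periodic k (U-periodic d) 0) ⟩
    W d (suc k) + W d k      ∎
    where
    open ≈-Reasoning
    g : ℕ → ℤ
    g = 𝓜^ k (U d)

  W-shift : ∀ d k → W (p ℕ.+ d) k ≈ W d (suc k)
  W-shift d k = +-cancelʳ (W d k) (≈-trans (≈-sym (binomial-mod-p W W-pascal d k)) (W-touchard d k))

  W-periodicity : ∀ m n k → W (p ℕ.* m ℕ.+ n) k ≈ W n (m ℕ.+ k)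
  W-periodicity zero    n k = ≈-reflexive (cong (λ d → W (d ℕ.+ n) k) (ℕ.*-zeroʳ p))
  W-periodicity (suc m) n k = begin
    W (p ℕ.* suc m ℕ.+ n) k       ≡⟨ cong (λ d → W d k) (trans (cong (ℕ._+ n) (ℕ.*-suc p m)) (ℕ.+-assoc p (p ℕ.* m) n)) ⟩
    W (p ℕ.+ (p ℕ.* m ℕ.+ n)) k   ≈⟨ W-shift (p ℕ.* m ℕ.+ n) k ⟩
    W (p ℕ.* m ℕ.+ n) (suc k)     ≈⟨ W-periodicity m n (suc k) ⟩
    W n (m ℕ.+ suc k)             ≡⟨ cong (W n) (ℕ.+-suc m k) ⟩
    W n (suc m ℕ.+ k)             ∎
    where open ≈-Reasoning


module PartitionCount where

  open import Function.Base using (_∘_)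
  open import Function.Bundles using (_⇔_; mk⇔; Equivalence)
  open import Data.Empty using (⊥-elim)
  open import Data.Unit.Base using (⊤; tt)
  open import Data.Product.Base using (_×_; _,_)
  open import Data.Bool.Base using (Bool; true; false; _∧_; _∨_; not; T)
  open import Data.Bool.Properties using (T-∧; ∨-identityʳ)
  open import Data.Bool.ListAction using (any)
  open import Data.Nat.Base using (zero; suc; _+_; _*_; _≡ᵇ_; _≤_; _<_; z≤n; s≤s)
  import Data.Nat.Properties as ℕ
  open import Data.Nat.Tactic.RingSolver using (solve-∀)
  open import Data.Fin.Base using (Fin; zero; suc; toℕ; fromℕ<)
  open import Data.Fin.Properties using (toℕ-injective; toℕ-fromℕ<)
  open import Data.Fin.Subset using (Subset; ⊥; ⁅_⁆; Nonempty; _∈_)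
  open import Data.Fin.Subset.Properties using (x∈p∩q⁺; x∈p∩q⁻)
  open import Data.Vec.Base as Vec using (Vec; []; _∷_; lookup; here; there)
  open import Data.Vec.Properties using ([]=⇒lookup; lookup⇒[]=; lookup-replicate)
  open import Data.List.Base using (List; []; _∷_; _++_; map; length; concatMap; replicate; null; filter)
  import Data.List.Properties as List
  open import Data.List.Relation.Unary.All as All using (All; []; _∷_)
  open import Data.List.Relation.Unary.AllPairs using (AllPairs; []; _∷_)
  open import Data.List.Relation.Unary.Any as Any using (Any; here; there)
  open import Data.List.Relation.Unary.Any.Properties using (any⁺; any⁻)
  open import Data.List.Membership.Propositional using () renaming (_∈_ to _∈ₗ_)
  open import Relation.Unary using (Decidable)
  open import Relation.Nullary.Negation using (¬_)
  open import Relation.Nullary.Decidable using (yes; no; _×-dec_)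
  open import Relation.Binary.Definitions using (tri<; tri≈; tri>)
  open import Relation.Binary.PropositionalEquality
  open import Defs using (sublists; allSubsets; A; IsPartition; LargestSingletonIs; Disjoint; isPartition?; largestSingletonIs?)
  open Equivalence using (to; from)

  ∑ₗ : ∀ {X : Set} → (X → ℕ) → List X → ℕ
  ∑ₗ f []       = 0
  ∑ₗ f (x ∷ xs) = f x + ∑ₗ f xs

  ⟦_⟧ : Bool → ℕ
  ⟦ true  ⟧ = 1
  ⟦ false ⟧ = 0

  ⟦∧⟧ : ∀ a b → ⟦ a ∧ b ⟧ ≡ ⟦ a ⟧ * ⟦ b ⟧
  ⟦∧⟧ true  b = sym (ℕ.+-identityʳ ⟦ b ⟧)
  ⟦∧⟧ false b = refl

  module _ {X : Set} where

    ∑ₗ-cong : ∀ {f g : X → ℕ} xs → f ≗ g → ∑ₗ f xs ≡ ∑ₗ g xs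
    ∑ₗ-cong []       f≗g = refl
    ∑ₗ-cong (x ∷ xs) f≗g = cong₂ _+_ (f≗g x) (∑ₗ-cong xs f≗g)

    ∑ₗ-zero : ∀ {f : X → ℕ} xs → f ≗ (λ _ → 0) → ∑ₗ f xs ≡ 0
    ∑ₗ-zero []       f≗0 = refl
    ∑ₗ-zero (x ∷ xs) f≗0 = cong₂ _+_ (f≗0 x) (∑ₗ-zero xs f≗0)

    ∑ₗ-++ : ∀ (f : X → ℕ) xs ys → ∑ₗ f (xs ++ ys) ≡ ∑ₗ f xs + ∑ₗ f ys
    ∑ₗ-++ f []       ys = refl
    ∑ₗ-++ f (x ∷ xs) ys = trans (cong (f x +_) (∑ₗ-++ f xs ys)) (sym (ℕ.+-assoc (f x) _ _))

    ∑ₗ-+ : ∀ (f g : X → ℕ) xs → ∑ₗ (λ x → f x + g x) xs ≡ ∑ₗ f xs + ∑ₗ g xs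
    ∑ₗ-+ f g []       = refl
    ∑ₗ-+ f g (x ∷ xs) = trans (cong (f x + g x +_) (∑ₗ-+ f g xs)) (shuffle (f x) (g x) _ _)
      where shuffle : ∀ a b c d → a + b + (c + d) ≡ a + c + (b + d)
            shuffle = solve-∀

    ∑ₗ-* : ∀ c (f : X → ℕ) xs → ∑ₗ (λ x → c * f x) xs ≡ c * ∑ₗ f xs
    ∑ₗ-* c f []       = sym (ℕ.*-zeroʳ c)
    ∑ₗ-* c f (x ∷ xs) = trans (cong (c * f x +_) (∑ₗ-* c f xs)) (sym (ℕ.*-distribˡ-+ c (f x) _))

  module _ {X Y : Set} where

    ∑ₗ-map : ∀ (f : Y → ℕ) (g : X → Y) xs → ∑ₗ f (map g xs) ≡ ∑ₗ (f ∘ g) xs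
    ∑ₗ-map f g []       = refl
    ∑ₗ-map f g (x ∷ xs) = cong (f (g x) +_) (∑ₗ-map f g xs)

    ∑ₗ-concatMap : ∀ (f : Y → ℕ) (g : X → List Y) xs → ∑ₗ f (concatMap g xs) ≡ ∑ₗ (∑ₗ f ∘ g) xs
    ∑ₗ-concatMap f g []       = refl
    ∑ₗ-concatMap f g (x ∷ xs) = trans (∑ₗ-++ f (g x) (concatMap g xs)) (cong (∑ₗ f (g x) +_) (∑ₗ-concatMap f g xs))

    ∑ₗ-comm : ∀ (f : X → Y → ℕ) xs ys → ∑ₗ (λ x → ∑ₗ (f x) ys) xs ≡ ∑ₗ (λ y → ∑ₗ (λ x → f x y) xs) ys
    ∑ₗ-comm f []       ys = sym (∑ₗ-zero ys (λ _ → refl))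
    ∑ₗ-comm f (x ∷ xs) ys = trans (cong (∑ₗ (f x) ys +_) (∑ₗ-comm f xs ys)) (sym (∑ₗ-+ (f x) (λ y → ∑ₗ (λ x → f x y) xs) ys))

    sublists-map : ∀ (g : X → Y) xs → sublists (map g xs) ≡ map (map g) (sublists xs)
    sublists-map g []       = refl
    sublists-map g (x ∷ xs) = begin
      sublists (map g xs) ++ map (g x ∷_) (sublists (map g xs))
        ≡⟨ cong (λ s → s ++ map (g x ∷_) s) (sublists-map g xs) ⟩
      map (map g) (sublists xs) ++ map (g x ∷_) (map (map g) (sublists xs))
        ≡⟨ cong (map (map g) (sublists xs) ++_) (List.map-∘ (sublists xs)) ⟨
      map (map g) (sublists xs) ++ map (map g ∘ (x ∷_)) (sublists xs)
        ≡⟨ cong (map (map g) (sublists xs) ++_) (List.map-∘ (sublists xs)) ⟩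
      map (map g) (sublists xs) ++ map (map g) (map (x ∷_) (sublists xs))     ≡⟨ List.map-++ (map g) (sublists xs) _ ⟨
      map (map g) (sublists (x ∷ xs))                                         ∎
      where open ≡-Reasoning

  c+[1+n]≡ᵇ1 : ∀ c n → (c + suc n ≡ᵇ 1) ≡ (c ≡ᵇ 0) ∧ (n ≡ᵇ 0)
  c+[1+n]≡ᵇ1 zero    n = refl
  c+[1+n]≡ᵇ1 (suc c) n rewrite ℕ.+-suc c n = refl

  module _ {X : Set} where

    ∑ₗ-sublists-++ : ∀ (f : List X → ℕ) xs ys →
      ∑ₗ f (sublists (xs ++ ys)) ≡ ∑ₗ (λ as → ∑ₗ (λ bs → f (as ++ bs)) (sublists ys)) (sublists xs)
    ∑ₗ-sublists-++ f []       ys = sym (ℕ.+-identityʳ _)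
    ∑ₗ-sublists-++ f (x ∷ xs) ys = begin
      ∑ₗ f (sublists (xs ++ ys) ++ map (x ∷_) (sublists (xs ++ ys)))         ≡⟨ ∑ₗ-++ f (sublists (xs ++ ys)) _ ⟩
      ∑ₗ f (sublists (xs ++ ys)) + ∑ₗ f (map (x ∷_) (sublists (xs ++ ys)))
        ≡⟨ cong₂ _+_ (∑ₗ-sublists-++ f xs ys)
                     (trans (∑ₗ-map f (x ∷_) (sublists (xs ++ ys))) (∑ₗ-sublists-++ (f ∘ (x ∷_)) xs ys)) ⟩
      ∑ₗ G (sublists xs) + ∑ₗ (G ∘ (x ∷_)) (sublists xs)
        ≡⟨ cong (∑ₗ G (sublists xs) +_) (∑ₗ-map G (x ∷_) (sublists xs)) ⟨
      ∑ₗ G (sublists xs) + ∑ₗ G (map (x ∷_) (sublists xs))                   ≡⟨ ∑ₗ-++ G (sublists xs) _ ⟨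
      ∑ₗ G (sublists (x ∷ xs))                                               ∎
      where
      open ≡-Reasoning
      G : List X → ℕ
      G as = ∑ₗ (λ bs → f (as ++ bs)) (sublists ys)

    ∑ₗ-sublists-empty : ∀ (f : List X → ℕ) xs → ∑ₗ (λ bs → ⟦ length bs ≡ᵇ 0 ⟧ * f bs) (sublists xs) ≡ f []
    ∑ₗ-sublists-empty f []       = trans (ℕ.+-identityʳ _) (ℕ.+-identityʳ (f []))
    ∑ₗ-sublists-empty f (x ∷ xs) = begin
      ∑ₗ g (sublists xs ++ map (x ∷_) (sublists xs))    ≡⟨ ∑ₗ-++ g (sublists xs) _ ⟩
      ∑ₗ g (sublists xs) + ∑ₗ g (map (x ∷_) (sublists xs))
        ≡⟨ cong₂ _+_ (∑ₗ-sublists-empty f xs) (trans (∑ₗ-map g (x ∷_) (sublists xs)) (∑ₗ-zero (sublists xs) (λ _ → refl))) ⟩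
      f [] + 0                                           ≡⟨ ℕ.+-identityʳ (f []) ⟩
      f []                                               ∎
      where
      open ≡-Reasoning
      g : List X → ℕ
      g bs = ⟦ length bs ≡ᵇ 0 ⟧ * f bs

    ∑ₗ-sublists-one : ∀ (f : List X → ℕ) c xs →
      ∑ₗ (λ bs → ⟦ c + length bs ≡ᵇ 1 ⟧ * f bs) (sublists xs) ≡ ⟦ c ≡ᵇ 1 ⟧ * f [] + ⟦ c ≡ᵇ 0 ⟧ * ∑ₗ (λ x → f (x ∷ [])) xs
    ∑ₗ-sublists-one f c []       = begin
      ⟦ c + 0 ≡ᵇ 1 ⟧ * f [] + 0        ≡⟨ cong (λ n → ⟦ n ≡ᵇ 1 ⟧ * f [] + 0) (ℕ.+-identityʳ c) ⟩
      ⟦ c ≡ᵇ 1 ⟧ * f [] + 0            ≡⟨ cong (⟦ c ≡ᵇ 1 ⟧ * f [] +_) (ℕ.*-zeroʳ ⟦ c ≡ᵇ 0 ⟧) ⟨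
      ⟦ c ≡ᵇ 1 ⟧ * f [] + ⟦ c ≡ᵇ 0 ⟧ * 0 ∎
      where open ≡-Reasoning
    ∑ₗ-sublists-one f c (x ∷ xs) = begin
      ∑ₗ g (sublists xs ++ map (x ∷_) (sublists xs))        ≡⟨ ∑ₗ-++ g (sublists xs) _ ⟩
      ∑ₗ g (sublists xs) + ∑ₗ g (map (x ∷_) (sublists xs))
        ≡⟨ cong₂ _+_ (∑ₗ-sublists-one f c xs) (trans (∑ₗ-map g (x ∷_) (sublists xs)) with-x) ⟩
      ⟦ c ≡ᵇ 1 ⟧ * f [] + ⟦ c ≡ᵇ 0 ⟧ * ∑ₗ (λ x → f (x ∷ [])) xs + ⟦ c ≡ᵇ 0 ⟧ * f (x ∷ [])
        ≡⟨ collect (⟦ c ≡ᵇ 1 ⟧ * f []) ⟦ c ≡ᵇ 0 ⟧ _ _ ⟩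
      ⟦ c ≡ᵇ 1 ⟧ * f [] + ⟦ c ≡ᵇ 0 ⟧ * ∑ₗ (λ x → f (x ∷ [])) (x ∷ xs) ∎
      where
      open ≡-Reasoning
      g : List X → ℕ
      g bs = ⟦ c + length bs ≡ᵇ 1 ⟧ * f bs
      collect : ∀ a i s t → a + i * s + i * t ≡ a + i * (t + s)
      collect = solve-∀
      with-x : ∑ₗ (g ∘ (x ∷_)) (sublists xs) ≡ ⟦ c ≡ᵇ 0 ⟧ * f (x ∷ [])
      with-x = begin
        ∑ₗ (g ∘ (x ∷_)) (sublists xs)
          ≡⟨ ∑ₗ-cong (sublists xs) (λ bs → trans (cong (λ b → ⟦ b ⟧ * f (x ∷ bs)) (c+[1+n]≡ᵇ1 c (length bs)))
                                          (trans (cong (_* f (x ∷ bs)) (⟦∧⟧ (c ≡ᵇ 0) _)) (ℕ.*-assoc ⟦ c ≡ᵇ 0 ⟧ _ _))) ⟩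
        ∑ₗ (λ bs → ⟦ c ≡ᵇ 0 ⟧ * (⟦ length bs ≡ᵇ 0 ⟧ * f (x ∷ bs))) (sublists xs) ≡⟨ ∑ₗ-* ⟦ c ≡ᵇ 0 ⟧ _ (sublists xs) ⟩
        ⟦ c ≡ᵇ 0 ⟧ * ∑ₗ (λ bs → ⟦ length bs ≡ᵇ 0 ⟧ * f (x ∷ bs)) (sublists xs)
          ≡⟨ cong (⟦ c ≡ᵇ 0 ⟧ *_) (∑ₗ-sublists-empty (f ∘ (x ∷_)) xs) ⟩
        ⟦ c ≡ᵇ 0 ⟧ * f (x ∷ [])                                               ∎

  words : ∀ {X : Set} → ℕ → List X → List (List X)
  words zero    xs = [] ∷ []
  words (suc a) xs = concatMap (λ x → map (x ∷_) (words a xs)) xs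

  module _ {X : Set} where

    ∑ₗ-words-suc : ∀ (f : List X → ℕ) a xs → ∑ₗ f (words (suc a) xs) ≡ ∑ₗ (λ x → ∑ₗ (f ∘ (x ∷_)) (words a xs)) xs
    ∑ₗ-words-suc f a xs = trans (∑ₗ-concatMap f _ xs) (∑ₗ-cong xs (λ x → ∑ₗ-map f (x ∷_) (words a xs)))

    ∑ₗ-words-[x] : ∀ (f : List X → ℕ) a x → ∑ₗ f (words a (x ∷ [])) ≡ f (replicate a x)
    ∑ₗ-words-[x] f zero    x = ℕ.+-identityʳ (f [])
    ∑ₗ-words-[x] f (suc a) x = trans (∑ₗ-words-suc f a (x ∷ [])) (trans (ℕ.+-identityʳ _) (∑ₗ-words-[x] (f ∘ (x ∷_)) a x))

  data Status : Set where
    free singleton nonSingleton : Status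

  module _ {n : ℕ} where

    inside₀ outside₀ tails : List (Subset (suc n)) → List (Subset n)
    inside₀ []                = []
    inside₀ ((true  ∷ s) ∷ F) = s ∷ inside₀ F
    inside₀ ((false ∷ s) ∷ F) = inside₀ F
    outside₀ []                = []
    outside₀ ((true  ∷ s) ∷ F) = outside₀ F
    outside₀ ((false ∷ s) ∷ F) = s ∷ outside₀ F
    tails = map Vec.tail

    count₀ : List (Subset (suc n)) → ℕ
    count₀ = ∑ₗ (⟦_⟧ ∘ Vec.head)

  multiplicity : ∀ {n} → Fin n → List (Subset n) → ℕ
  multiplicity x = ∑ₗ (λ s → ⟦ lookup s x ⟧)

  isEmpty? : ∀ {n} → Subset n → Bool
  isEmpty? []      = true
  isEmpty? (b ∷ s) = not b ∧ isEmpty? s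

  statusOk? : ∀ {n} → Status → List (Subset n) → Bool
  statusOk? free         I = true
  statusOk? singleton    I = any isEmpty? I
  statusOk? nonSingleton I = not (any isEmpty? I)

  -- Elements are processed from the first one on; e holds the sets already opened
  -- (restricted to the remaining elements).  The first element must lie in exactly one
  -- member of e ++ F, and the blocks of F through it are opened for the later elements.
  admissible? : ∀ {N} → Vec Status N → List (Subset N) → List (Subset N) → Bool
  admissible? []       e F = null F
  admissible? (σ ∷ w) e F =
    (count₀ e + length (inside₀ F) ≡ᵇ 1) ∧ statusOk? σ (inside₀ F) ∧ admissible? w (inside₀ F ++ tails e) (outside₀ F)

  HasStatus : ∀ {n} → Status → Fin n → List (Subset n) → Set
  HasStatus free         x F = ⊤
  HasStatus singleton    x F = ⁅ x ⁆ ∈ₗ F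
  HasStatus nonSingleton x F = ¬ ⁅ x ⁆ ∈ₗ F

  Admissible : ∀ {N} → Vec Status N → List (Subset N) → List (Subset N) → Set
  Admissible w e F = All Nonempty F × (∀ x → multiplicity x (e ++ F) ≡ 1) × (∀ x → HasStatus (lookup w x) x F)

  module _ {n : ℕ} where

    count₀≡length-inside₀ : (F : List (Subset (suc n))) → count₀ F ≡ length (inside₀ F)
    count₀≡length-inside₀ []                = refl
    count₀≡length-inside₀ ((true  ∷ s) ∷ F) = cong suc (count₀≡length-inside₀ F)
    count₀≡length-inside₀ ((false ∷ s) ∷ F) = count₀≡length-inside₀ F

    ∑ₗ-tails : ∀ (f : Subset n → ℕ) F → ∑ₗ f (tails F) ≡ ∑ₗ f (inside₀ F) + ∑ₗ f (outside₀ F)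
    ∑ₗ-tails f []                = refl
    ∑ₗ-tails f ((true  ∷ s) ∷ F) = trans (cong (f s +_) (∑ₗ-tails f F)) (sym (ℕ.+-assoc (f s) _ _))
    ∑ₗ-tails f ((false ∷ s) ∷ F) = trans (cong (f s +_) (∑ₗ-tails f F)) (swap (f s) (∑ₗ f (inside₀ F)) (∑ₗ f (outside₀ F)))
      where swap : ∀ a b c → a + (b + c) ≡ b + (a + c)
            swap = solve-∀

    multiplicity-zero : ∀ e F → multiplicity zero (e ++ F) ≡ count₀ e + length (inside₀ F)
    multiplicity-zero e F = begin
      multiplicity zero (e ++ F)           ≡⟨ ∑ₗ-cong (e ++ F) (λ { (b ∷ s) → refl }) ⟩
      count₀ (e ++ F)                      ≡⟨ ∑ₗ-++ _ e F ⟩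
      count₀ e + count₀ F                  ≡⟨ cong (count₀ e +_) (count₀≡length-inside₀ F) ⟩
      count₀ e + length (inside₀ F)        ∎
      where open ≡-Reasoning

    multiplicity-suc : ∀ y e F → multiplicity (suc y) (e ++ F) ≡ multiplicity y ((inside₀ F ++ tails e) ++ outside₀ F)
    multiplicity-suc y e F = begin
      multiplicity (suc y) (e ++ F)                  ≡⟨ ∑ₗ-cong (e ++ F) (λ { (b ∷ s) → refl }) ⟩
      ∑ₗ (m ∘ Vec.tail) (e ++ F)                      ≡⟨ ∑ₗ-map m Vec.tail (e ++ F) ⟨
      ∑ₗ m (tails (e ++ F))                           ≡⟨ cong (∑ₗ m) (List.map-++ Vec.tail e F) ⟩
      ∑ₗ m (tails e ++ tails F)                       ≡⟨ ∑ₗ-++ m (tails e) (tails F) ⟩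
      ∑ₗ m (tails e) + ∑ₗ m (tails F)                 ≡⟨ cong (∑ₗ m (tails e) +_) (∑ₗ-tails m F) ⟩
      ∑ₗ m (tails e) + (∑ₗ m (inside₀ F) + ∑ₗ m (outside₀ F))
        ≡⟨ rearrange (∑ₗ m (tails e)) (∑ₗ m (inside₀ F)) (∑ₗ m (outside₀ F)) ⟩
      (∑ₗ m (inside₀ F) + ∑ₗ m (tails e)) + ∑ₗ m (outside₀ F) ≡⟨ cong (_+ ∑ₗ m (outside₀ F)) (∑ₗ-++ m (inside₀ F) (tails e)) ⟨
      ∑ₗ m (inside₀ F ++ tails e) + ∑ₗ m (outside₀ F) ≡⟨ ∑ₗ-++ m (inside₀ F ++ tails e) (outside₀ F) ⟨
      multiplicity y ((inside₀ F ++ tails e) ++ outside₀ F) ∎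
      where
      open ≡-Reasoning
      m : Subset n → ℕ
      m s = ⟦ lookup s y ⟧
      rearrange : ∀ a b c → a + (b + c) ≡ (b + a) + c
      rearrange = solve-∀

    All-nonempty-outside₀ : ∀ (F : List (Subset (suc n))) → All Nonempty F ⇔ All Nonempty (outside₀ F)
    All-nonempty-outside₀ F = mk⇔ (restrict F) (extend F)
      where
      restrict : ∀ F → All Nonempty F → All Nonempty (outside₀ F)
      restrict []                _                         = []
      restrict ((true  ∷ s) ∷ F) (_ ∷ ne)                  = restrict F ne
      restrict ((false ∷ s) ∷ F) ((suc x , there x∈) ∷ ne) = (x , x∈) ∷ restrict F ne
      extend : ∀ F → All Nonempty (outside₀ F) → All Nonempty F
      extend []                _               = []
      extend ((true  ∷ s) ∷ F) ne              = (zero , here) ∷ extend F ne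
      extend ((false ∷ s) ∷ F) ((x , x∈) ∷ ne) = (suc x , there x∈) ∷ extend F ne

    ∈-inside₀ : ∀ s (F : List (Subset (suc n))) → (true ∷ s) ∈ₗ F ⇔ s ∈ₗ inside₀ F
    ∈-inside₀ s F = mk⇔ (restrict F) (extend F)
      where
      restrict : ∀ F → (true ∷ s) ∈ₗ F → s ∈ₗ inside₀ F
      restrict ((true  ∷ t) ∷ F) (here refl) = here refl
      restrict ((true  ∷ t) ∷ F) (there s∈)  = there (restrict F s∈)
      restrict ((false ∷ t) ∷ F) (there s∈)  = restrict F s∈
      extend : ∀ F → s ∈ₗ inside₀ F → (true ∷ s) ∈ₗ F
      extend ((true  ∷ t) ∷ F) (here refl) = here refl
      extend ((true  ∷ t) ∷ F) (there s∈)  = there (extend F s∈)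
      extend ((false ∷ t) ∷ F) s∈          = there (extend F s∈)

    ∈-outside₀ : ∀ s (F : List (Subset (suc n))) → (false ∷ s) ∈ₗ F ⇔ s ∈ₗ outside₀ F
    ∈-outside₀ s F = mk⇔ (restrict F) (extend F)
      where
      restrict : ∀ F → (false ∷ s) ∈ₗ F → s ∈ₗ outside₀ F
      restrict ((false ∷ t) ∷ F) (here refl) = here refl
      restrict ((false ∷ t) ∷ F) (there s∈)  = there (restrict F s∈)
      restrict ((true  ∷ t) ∷ F) (there s∈)  = restrict F s∈
      extend : ∀ F → s ∈ₗ outside₀ F → (false ∷ s) ∈ₗ F
      extend ((false ∷ t) ∷ F) (here refl) = here refl
      extend ((false ∷ t) ∷ F) (there s∈)  = there (extend F s∈)
      extend ((true  ∷ t) ∷ F) s∈          = there (extend F s∈)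

  isEmpty?⇔≡⊥ : ∀ {n} {s : Subset n} → T (isEmpty? s) ⇔ s ≡ ⊥
  isEmpty?⇔≡⊥ {n} = mk⇔ (to′ _) (λ { refl → from′ n })
    where
    to′ : ∀ {n} (s : Subset n) → T (isEmpty? s) → s ≡ ⊥
    to′ []          _ = refl
    to′ (false ∷ s) h = cong (false ∷_) (to′ s h)
    from′ : ∀ n → T (isEmpty? (⊥ {n}))
    from′ zero    = tt
    from′ (suc n) = from′ n

  ⊥∈ₗ⇔any-isEmpty? : ∀ {n} (I : List (Subset n)) → ⊥ ∈ₗ I ⇔ T (any isEmpty? I)
  ⊥∈ₗ⇔any-isEmpty? I = mk⇔
    (λ ⊥∈I → any⁺ isEmpty? (Any.map (λ ⊥≡s → from isEmpty?⇔≡⊥ (sym ⊥≡s)) ⊥∈I))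
    (λ h → Any.map (λ empty → sym (to isEmpty?⇔≡⊥ empty)) (any⁻ isEmpty? I h))

  T-not : ∀ {b} → T (not b) ⇔ (¬ T b)
  T-not {true}  = mk⇔ (λ ()) (λ ¬tt → ¬tt tt)
  T-not {false} = mk⇔ (λ _ ()) (λ _ → tt)

  module _ {n : ℕ} where

    status-zero : ∀ σ (F : List (Subset (suc n))) → HasStatus σ zero F ⇔ T (statusOk? σ (inside₀ F))
    status-zero free         F = mk⇔ (λ _ → tt) (λ _ → tt)
    status-zero singleton    F = mk⇔ (to ⊥∈inside₀ ∘ to (∈-inside₀ ⊥ F)) (from (∈-inside₀ ⊥ F) ∘ from ⊥∈inside₀)
      where ⊥∈inside₀ = ⊥∈ₗ⇔any-isEmpty? {n} (inside₀ F)
    status-zero nonSingleton F = mk⇔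
      (λ ∉ → from T-not (λ h → ∉ (from (∈-inside₀ ⊥ F) (from (⊥∈ₗ⇔any-isEmpty? (inside₀ F)) h))))
      (λ h ∈ → to T-not h (to (⊥∈ₗ⇔any-isEmpty? (inside₀ F)) (to (∈-inside₀ ⊥ F) ∈)))

    status-suc : ∀ σ y (F : List (Subset (suc n))) → HasStatus σ (suc y) F ⇔ HasStatus σ y (outside₀ F)
    status-suc free         y F = mk⇔ (λ _ → tt) (λ _ → tt)
    status-suc singleton    y F = ∈-outside₀ ⁅ y ⁆ F
    status-suc nonSingleton y F = mk⇔ (λ ∉ ∈ → ∉ (from (∈-outside₀ ⁅ y ⁆ F) ∈)) (λ ∉ ∈ → ∉ (to (∈-outside₀ ⁅ y ⁆ F) ∈))

  admissible?-sound : ∀ {N} (w : Vec Status N) e F → T (admissible? w e F) → Admissible w e F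
  admissible?-sound []      e []      _ = [] , (λ ()) , (λ ())
  admissible?-sound (σ ∷ w) e F h
    with one , h′            ← to T-∧ h
    with ok , rest           ← to T-∧ h′
    with ne , mult , status  ← admissible?-sound w (inside₀ F ++ tails e) (outside₀ F) rest
    = from (All-nonempty-outside₀ F) ne
    , (λ { zero    → trans (multiplicity-zero e F) (ℕ.≡ᵇ⇒≡ _ 1 one)
         ; (suc y) → trans (multiplicity-suc y e F) (mult y) })
    , (λ { zero    → from (status-zero σ F) ok
         ; (suc y) → from (status-suc (lookup w y) y F) (status y) })

  admissible?-complete : ∀ {N} (w : Vec Status N) e F → Admissible w e F → T (admissible? w e F)
  admissible?-complete []      e []      _                  = tt
  admissible?-complete []      e (s ∷ F) (((() , _) ∷ _) , _)
  admissible?-complete (σ ∷ w) e F (ne , mult , status) = from T-∧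
    ( ℕ.≡⇒≡ᵇ _ 1 (trans (sym (multiplicity-zero e F)) (mult zero))
    , from T-∧
      ( to (status-zero σ F) (status zero)
      , admissible?-complete w (inside₀ F ++ tails e) (outside₀ F)
          ( to (All-nonempty-outside₀ F) ne
          , (λ y → trans (sym (multiplicity-suc y e F)) (mult (suc y)))
          , (λ y → to (status-suc (lookup w y) y F) (status (suc y))))))

  completions : ∀ {N} → Vec Status N → List (Subset N) → ℕ
  completions {N} w e = ∑ₗ (λ F → ⟦ admissible? w e F ⟧) (sublists (allSubsets N))

  -- partitionsWith a w counts the ways to split the N elements into a labelled, possibly
  -- empty, sets and a partition of the remaining ones whose blocks respect the statuses w.
  partitionsWith : ∀ {N} → ℕ → Vec Status N → ℕ
  partitionsWith {N} a w = ∑ₗ (completions w) (words a (allSubsets N))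

  partitionsWith-[] : ∀ a → partitionsWith a [] ≡ 1
  partitionsWith-[] a = ∑ₗ-words-[x] (completions []) a []

  T-injective : ∀ {a b} → (T a ⇔ T b) → a ≡ b
  T-injective {true}  {true}  _   = refl
  T-injective {true}  {false} a⇔b = ⊥-elim (to a⇔b tt)
  T-injective {false} {true}  a⇔b = ⊥-elim (from a⇔b tt)
  T-injective {false} {false} _   = refl

  lookup-⊥ : ∀ {n} (x : Fin n) → lookup ⊥ x ≡ false
  lookup-⊥ zero    = refl
  lookup-⊥ (suc x) = lookup-⊥ x

  completions-⊥ : ∀ {N} (w : Vec Status N) e → completions w (⊥ ∷ e) ≡ completions w e
  completions-⊥ {N} w e = ∑ₗ-cong (sublists (allSubsets N)) (λ F → cong ⟦_⟧ (T-injective (mk⇔ (drop F) (add F))))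
    where
    ⊥-uncounted : ∀ x L → multiplicity x (⊥ ∷ L) ≡ multiplicity x L
    ⊥-uncounted x L = cong (λ b → ⟦ b ⟧ + multiplicity x L) (lookup-⊥ x)
    drop : ∀ F → T (admissible? w (⊥ ∷ e) F) → T (admissible? w e F)
    drop F h with ne , mult , status ← admissible?-sound w (⊥ ∷ e) F h =
      admissible?-complete w e F (ne , (λ x → trans (sym (⊥-uncounted x (e ++ F))) (mult x)) , status)
    add : ∀ F → T (admissible? w e F) → T (admissible? w (⊥ ∷ e) F)
    add F h with ne , mult , status ← admissible?-sound w e F h =
      admissible?-complete w (⊥ ∷ e) F (ne , (λ x → trans (⊥-uncounted x (e ++ F)) (mult x)) , status)

  ∑ₗ-allSubsets-isEmpty : ∀ N (f : Subset N → ℕ) → ∑ₗ (λ s → ⟦ isEmpty? s ⟧ * f s) (allSubsets N) ≡ f ⊥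
  ∑ₗ-allSubsets-isEmpty zero    f = trans (ℕ.+-identityʳ _) (ℕ.+-identityʳ (f []))
  ∑ₗ-allSubsets-isEmpty (suc N) f = begin
    ∑ₗ g (map (false ∷_) L ++ map (true ∷_) L)             ≡⟨ ∑ₗ-++ g (map (false ∷_) L) _ ⟩
    ∑ₗ g (map (false ∷_) L) + ∑ₗ g (map (true ∷_) L)
      ≡⟨ cong₂ _+_ (∑ₗ-map g (false ∷_) L) (trans (∑ₗ-map g (true ∷_) L) (∑ₗ-zero L (λ _ → refl))) ⟩
    ∑ₗ (λ s → ⟦ isEmpty? s ⟧ * f (false ∷ s)) L + 0        ≡⟨ ℕ.+-identityʳ _ ⟩
    ∑ₗ (λ s → ⟦ isEmpty? s ⟧ * f (false ∷ s)) L            ≡⟨ ∑ₗ-allSubsets-isEmpty N (f ∘ (false ∷_)) ⟩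
    f ⊥                                                    ∎
    where
    open ≡-Reasoning
    L = allSubsets N
    g : Subset (suc N) → ℕ
    g s = ⟦ isEmpty? s ⟧ * f s

  ∑ₗ-allSubsets-nonempty : ∀ N (f : Subset N → ℕ) →
    ∑ₗ (λ s → ⟦ not (isEmpty? s) ⟧ * f s) (allSubsets N) + f ⊥ ≡ ∑ₗ f (allSubsets N)
  ∑ₗ-allSubsets-nonempty N f = begin
    ∑ₗ (λ s → ⟦ not (isEmpty? s) ⟧ * f s) L + f ⊥
      ≡⟨ cong (∑ₗ (λ s → ⟦ not (isEmpty? s) ⟧ * f s) L +_) (∑ₗ-allSubsets-isEmpty N f) ⟨
    ∑ₗ (λ s → ⟦ not (isEmpty? s) ⟧ * f s) L + ∑ₗ (λ s → ⟦ isEmpty? s ⟧ * f s) L ≡⟨ ∑ₗ-+ _ _ L ⟨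
    ∑ₗ (λ s → ⟦ not (isEmpty? s) ⟧ * f s + ⟦ isEmpty? s ⟧ * f s) L         ≡⟨ ∑ₗ-cong L (λ s → split (isEmpty? s) (f s)) ⟩
    ∑ₗ f L                                                                 ∎
    where
    open ≡-Reasoning
    L = allSubsets N
    split : ∀ b x → ⟦ not b ⟧ * x + ⟦ b ⟧ * x ≡ x
    split true  x = ℕ.*-identityˡ x
    split false x = trans (ℕ.+-identityʳ _) (ℕ.*-identityˡ x)

  module _ {n : ℕ} where

    inside₀-split : (Fo Fi : List (Subset n)) → inside₀ (map (false ∷_) Fo ++ map (true ∷_) Fi) ≡ Fi
    inside₀-split []       []       = refl
    inside₀-split []       (s ∷ Fi) = cong (s ∷_) (inside₀-split [] Fi)
    inside₀-split (s ∷ Fo) Fi       = inside₀-split Fo Fi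

    outside₀-split : (Fo Fi : List (Subset n)) → outside₀ (map (false ∷_) Fo ++ map (true ∷_) Fi) ≡ Fo
    outside₀-split []       []       = refl
    outside₀-split []       (s ∷ Fi) = outside₀-split [] Fi
    outside₀-split (s ∷ Fo) Fi       = cong (s ∷_) (outside₀-split Fo Fi)

  module _ {N : ℕ} (σ : Status) (w : Vec Status N) where

    coveredFirst newBlockFirst : List (Subset N) → ℕ
    coveredFirst  e = ⟦ statusOk? {N} σ [] ⟧ * completions w e
    newBlockFirst e = ∑ₗ (λ s → ⟦ statusOk? σ (s ∷ []) ⟧ * completions w (s ∷ e)) (allSubsets N)

    completions-step : ∀ e′ → completions (σ ∷ w) e′ ≡
      ⟦ count₀ e′ ≡ᵇ 1 ⟧ * coveredFirst (tails e′) + ⟦ count₀ e′ ≡ᵇ 0 ⟧ * newBlockFirst (tails e′)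
    completions-step e′ = begin
      ∑ₗ g (sublists (map (false ∷_) L ++ map (true ∷_) L))
        ≡⟨ ∑ₗ-sublists-++ g (map (false ∷_) L) (map (true ∷_) L) ⟩
      ∑ₗ (λ Fo → ∑ₗ (λ Fi → g (Fo ++ Fi)) (sublists (map (true ∷_) L))) (sublists (map (false ∷_) L))
        ≡⟨ cong₂ (λ u v → ∑ₗ (λ Fo → ∑ₗ (λ Fi → g (Fo ++ Fi)) v) u) (sublists-map (false ∷_) L) (sublists-map (true ∷_) L) ⟩
      ∑ₗ (λ Fo → ∑ₗ (λ Fi → g (Fo ++ Fi)) (map (map (true ∷_)) (sublists L))) (map (map (false ∷_)) (sublists L))
        ≡⟨ ∑ₗ-map _ (map (false ∷_)) (sublists L) ⟩
      ∑ₗ (λ Fo → ∑ₗ (λ Fi → g (map (false ∷_) Fo ++ Fi)) (map (map (true ∷_)) (sublists L))) (sublists L)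
        ≡⟨ ∑ₗ-cong (sublists L) (λ Fo → trans (∑ₗ-map _ (map (true ∷_)) (sublists L)) (∑ₗ-cong (sublists L) (split Fo))) ⟩
      ∑ₗ (λ Fo → ∑ₗ (λ Fi → h Fo Fi) (sublists L)) (sublists L)
        ≡⟨ ∑ₗ-comm h (sublists L) (sublists L) ⟩
      ∑ₗ (λ Fi → ∑ₗ (λ Fo → h Fo Fi) (sublists L)) (sublists L)
        ≡⟨ ∑ₗ-cong (sublists L) (λ Fi → trans (∑ₗ-* (exactlyOne Fi) _ (sublists L))
                                              (cong (exactlyOne Fi *_) (∑ₗ-* ⟦ statusOk? σ Fi ⟧ _ (sublists L)))) ⟩
      ∑ₗ (λ Fi → exactlyOne Fi * φ Fi) (sublists L)
        ≡⟨ ∑ₗ-sublists-one φ c L ⟩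
      ⟦ c ≡ᵇ 1 ⟧ * coveredFirst (tails e′) + ⟦ c ≡ᵇ 0 ⟧ * newBlockFirst (tails e′) ∎
      where
      open ≡-Reasoning
      L = allSubsets N
      c = count₀ e′
      g : List (Subset (suc N)) → ℕ
      g F = ⟦ admissible? (σ ∷ w) e′ F ⟧
      exactlyOne : List (Subset N) → ℕ
      exactlyOne Fi = ⟦ c + length Fi ≡ᵇ 1 ⟧
      h : List (Subset N) → List (Subset N) → ℕ
      h Fo Fi = exactlyOne Fi * (⟦ statusOk? σ Fi ⟧ * ⟦ admissible? w (Fi ++ tails e′) Fo ⟧)
      φ : List (Subset N) → ℕ
      φ Fi = ⟦ statusOk? σ Fi ⟧ * completions w (Fi ++ tails e′)
      split : ∀ Fo Fi → g (map (false ∷_) Fo ++ map (true ∷_) Fi) ≡ h Fo Fi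
      split Fo Fi = begin
        ⟦ (c + length I ≡ᵇ 1) ∧ (statusOk? σ I ∧ admissible? w (I ++ tails e′) O) ⟧
          ≡⟨ ⟦∧⟧ (c + length I ≡ᵇ 1) _ ⟩
        ⟦ c + length I ≡ᵇ 1 ⟧ * ⟦ statusOk? σ I ∧ admissible? w (I ++ tails e′) O ⟧
          ≡⟨ cong (⟦ c + length I ≡ᵇ 1 ⟧ *_) (⟦∧⟧ (statusOk? σ I) _) ⟩
        ⟦ c + length I ≡ᵇ 1 ⟧ * (⟦ statusOk? σ I ⟧ * ⟦ admissible? w (I ++ tails e′) O ⟧)
          ≡⟨ cong₂ (λ I O → ⟦ c + length I ≡ᵇ 1 ⟧ * (⟦ statusOk? σ I ⟧ * ⟦ admissible? w (I ++ tails e′) O ⟧))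
                   (inside₀-split Fo Fi) (outside₀-split Fo Fi) ⟩
        h Fo Fi ∎
        where
        I = inside₀ (map (false ∷_) Fo ++ map (true ∷_) Fi)
        O = outside₀ (map (false ∷_) Fo ++ map (true ∷_) Fi)

  module _ {N : ℕ} where

    private
      L  = allSubsets N
      L′ = allSubsets (suc N)

    ∑ₗ-words-by-head : ∀ a (f : List (Subset (suc N)) → ℕ) → ∑ₗ f (words (suc a) L′) ≡
      ∑ₗ (λ x → ∑ₗ (λ v → f ((false ∷ x) ∷ v)) (words a L′)) L + ∑ₗ (λ x → ∑ₗ (λ v → f ((true ∷ x) ∷ v)) (words a L′)) L
    ∑ₗ-words-by-head a f = begin
      ∑ₗ f (words (suc a) L′)                                   ≡⟨ ∑ₗ-words-suc f a L′ ⟩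
      ∑ₗ g (map (false ∷_) L ++ map (true ∷_) L)               ≡⟨ ∑ₗ-++ g (map (false ∷_) L) (map (true ∷_) L) ⟩
      ∑ₗ g (map (false ∷_) L) + ∑ₗ g (map (true ∷_) L)         ≡⟨ cong₂ _+_ (∑ₗ-map g (false ∷_) L) (∑ₗ-map g (true ∷_) L) ⟩
      ∑ₗ (g ∘ (false ∷_)) L + ∑ₗ (g ∘ (true ∷_)) L             ∎
      where
      open ≡-Reasoning
      g : Subset (suc N) → ℕ
      g x = ∑ₗ (f ∘ (x ∷_)) (words a L′)

    ∑ₗ-words-count₀≡0 : ∀ a (ψ : List (Subset N) → ℕ) →
      ∑ₗ (λ e′ → ⟦ count₀ e′ ≡ᵇ 0 ⟧ * ψ (tails e′)) (words a L′) ≡ ∑ₗ ψ (words a L)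
    ∑ₗ-words-count₀≡0 zero    ψ = cong (_+ 0) (ℕ.*-identityˡ _)
    ∑ₗ-words-count₀≡0 (suc a) ψ = begin
      _                                                          ≡⟨ ∑ₗ-words-by-head a _ ⟩
      ∑ₗ (λ x → ∑ₗ (λ e′ → ⟦ count₀ e′ ≡ᵇ 0 ⟧ * ψ (x ∷ tails e′)) (words a L′)) L + ∑ₗ (λ _ → ∑ₗ (λ _ → 0) (words a L′)) L
        ≡⟨ cong₂ _+_ (∑ₗ-cong L (λ x → ∑ₗ-words-count₀≡0 a (ψ ∘ (x ∷_)))) (∑ₗ-zero L (λ _ → ∑ₗ-zero (words a L′) (λ _ → refl))) ⟩
      ∑ₗ (λ x → ∑ₗ (ψ ∘ (x ∷_)) (words a L)) L + 0                ≡⟨ ℕ.+-identityʳ _ ⟩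
      ∑ₗ (λ x → ∑ₗ (ψ ∘ (x ∷_)) (words a L)) L                    ≡⟨ ∑ₗ-words-suc ψ a L ⟨
      ∑ₗ ψ (words (suc a) L)                                      ∎
      where open ≡-Reasoning

    ∑ₗ-words-count₀≡1 : ∀ a (ψ : List (Subset N) → ℕ) →
      ∑ₗ (λ e′ → ⟦ count₀ e′ ≡ᵇ 1 ⟧ * ψ (tails e′)) (words a L′) ≡ a * ∑ₗ ψ (words a L)
    ∑ₗ-words-count₀≡1 zero    ψ = refl
    ∑ₗ-words-count₀≡1 (suc a) ψ = begin
      _                                                          ≡⟨ ∑ₗ-words-by-head a _ ⟩
      ∑ₗ (λ x → ∑ₗ (λ e′ → ⟦ count₀ e′ ≡ᵇ 1 ⟧ * ψ (x ∷ tails e′)) (words a L′)) L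
        + ∑ₗ (λ x → ∑ₗ (λ e′ → ⟦ count₀ e′ ≡ᵇ 0 ⟧ * ψ (x ∷ tails e′)) (words a L′)) L
        ≡⟨ cong₂ _+_ (∑ₗ-cong L (λ x → ∑ₗ-words-count₀≡1 a (ψ ∘ (x ∷_)))) (∑ₗ-cong L (λ x → ∑ₗ-words-count₀≡0 a (ψ ∘ (x ∷_)))) ⟩
      ∑ₗ (λ x → a * S x) L + ∑ₗ S L                               ≡⟨ cong (_+ ∑ₗ S L) (∑ₗ-* a S L) ⟩
      a * ∑ₗ S L + ∑ₗ S L                                         ≡⟨ ℕ.+-comm (a * ∑ₗ S L) _ ⟩
      suc a * ∑ₗ S L                                              ≡⟨ cong (suc a *_) (∑ₗ-words-suc ψ a L) ⟨
      suc a * ∑ₗ ψ (words (suc a) L)                              ∎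
      where
      open ≡-Reasoning
      S : Subset N → ℕ
      S x = ∑ₗ (ψ ∘ (x ∷_)) (words a L)

  module _ {N : ℕ} (w : Vec Status N) where

    private
      L = allSubsets N

    partitionsWith-step : ∀ σ a → partitionsWith a (σ ∷ w) ≡
      a * (⟦ statusOk? {N} σ [] ⟧ * partitionsWith a w) + ∑ₗ (newBlockFirst σ w) (words a L)
    partitionsWith-step σ a = begin
      ∑ₗ (completions (σ ∷ w)) (words a (allSubsets (suc N)))
        ≡⟨ ∑ₗ-cong (words a (allSubsets (suc N))) (completions-step σ w) ⟩
      ∑ₗ (λ e′ → ⟦ count₀ e′ ≡ᵇ 1 ⟧ * coveredFirst σ w (tails e′) + ⟦ count₀ e′ ≡ᵇ 0 ⟧ * newBlockFirst σ w (tails e′))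
         (words a (allSubsets (suc N)))
        ≡⟨ ∑ₗ-+ _ _ (words a (allSubsets (suc N))) ⟩
      _ ≡⟨ cong₂ _+_ (∑ₗ-words-count₀≡1 a (coveredFirst σ w)) (∑ₗ-words-count₀≡0 a (newBlockFirst σ w)) ⟩
      a * ∑ₗ (coveredFirst σ w) (words a L) + ∑ₗ (newBlockFirst σ w) (words a L)
        ≡⟨ cong (λ s → a * s + ∑ₗ (newBlockFirst σ w) (words a L)) (∑ₗ-* ⟦ statusOk? {N} σ [] ⟧ (completions w) (words a L)) ⟩
      a * (⟦ statusOk? {N} σ [] ⟧ * partitionsWith a w) + ∑ₗ (newBlockFirst σ w) (words a L) ∎
      where open ≡-Reasoning

    partitionsWith-suc : ∀ a → ∑ₗ (λ e → ∑ₗ (λ s → completions w (s ∷ e)) L) (words a L) ≡ partitionsWith (suc a) w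
    partitionsWith-suc a = trans (∑ₗ-comm (λ e s → completions w (s ∷ e)) (words a L) L) (sym (∑ₗ-words-suc (completions w) a L))

    partitionsWith-free : ∀ a → partitionsWith a (free ∷ w) ≡ a * partitionsWith a w + partitionsWith (suc a) w
    partitionsWith-free a = trans (partitionsWith-step free a) (cong₂ _+_ (cong (a *_) (ℕ.*-identityˡ (partitionsWith a w)))
      (trans (∑ₗ-cong (words a L) (λ e → ∑ₗ-cong L (λ s → ℕ.*-identityˡ (completions w (s ∷ e))))) (partitionsWith-suc a)))

    partitionsWith-singleton : ∀ a → partitionsWith a (singleton ∷ w) ≡ partitionsWith a w
    partitionsWith-singleton a = begin
      partitionsWith a (singleton ∷ w)                                    ≡⟨ partitionsWith-step singleton a ⟩
      a * 0 + ∑ₗ (newBlockFirst singleton w) (words a L)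
        ≡⟨ cong (_+ ∑ₗ (newBlockFirst singleton w) (words a L)) (ℕ.*-zeroʳ a) ⟩
      ∑ₗ (newBlockFirst singleton w) (words a L)                           ≡⟨ ∑ₗ-cong (words a L) only-empty ⟩
      partitionsWith a w                                                  ∎
      where
      open ≡-Reasoning
      only-empty : ∀ e → newBlockFirst singleton w e ≡ completions w e
      only-empty e = begin
        ∑ₗ (λ s → ⟦ isEmpty? s ∨ false ⟧ * completions w (s ∷ e)) L
          ≡⟨ ∑ₗ-cong L (λ s → cong (λ b → ⟦ b ⟧ * completions w (s ∷ e)) (∨-identityʳ (isEmpty? s))) ⟩
        ∑ₗ (λ s → ⟦ isEmpty? s ⟧ * completions w (s ∷ e)) L         ≡⟨ ∑ₗ-allSubsets-isEmpty N (λ s → completions w (s ∷ e)) ⟩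
        completions w (⊥ ∷ e)                                       ≡⟨ completions-⊥ w e ⟩
        completions w e                                             ∎

    partitionsWith-nonSingleton : ∀ a →
      partitionsWith a (nonSingleton ∷ w) + partitionsWith a w ≡ a * partitionsWith a w + partitionsWith (suc a) w
    partitionsWith-nonSingleton a = begin
      partitionsWith a (nonSingleton ∷ w) + partitionsWith a w
        ≡⟨ cong (_+ partitionsWith a w) (partitionsWith-step nonSingleton a) ⟩
      a * (1 * partitionsWith a w) + ∑ₗ (newBlockFirst nonSingleton w) (words a L) + partitionsWith a w
        ≡⟨ ℕ.+-assoc (a * (1 * partitionsWith a w)) _ _ ⟩
      a * (1 * partitionsWith a w) + (∑ₗ (newBlockFirst nonSingleton w) (words a L) + partitionsWith a w)
        ≡⟨ cong₂ _+_ (cong (a *_) (ℕ.*-identityˡ (partitionsWith a w))) (sym (∑ₗ-+ (newBlockFirst nonSingleton w) (completions w) (words a L))) ⟩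
      a * partitionsWith a w + ∑ₗ (λ e → newBlockFirst nonSingleton w e + completions w e) (words a L)
        ≡⟨ cong (a * partitionsWith a w +_) (trans (∑ₗ-cong (words a L) nonempty-or-empty) (partitionsWith-suc a)) ⟩
      a * partitionsWith a w + partitionsWith (suc a) w ∎
      where
      open ≡-Reasoning
      nonempty-or-empty : ∀ e → newBlockFirst nonSingleton w e + completions w e ≡ ∑ₗ (λ s → completions w (s ∷ e)) L
      nonempty-or-empty e = begin
        ∑ₗ (λ s → ⟦ not (isEmpty? s ∨ false) ⟧ * completions w (s ∷ e)) L + completions w e
          ≡⟨ cong₂ _+_ (∑ₗ-cong L (λ s → cong (λ b → ⟦ not b ⟧ * completions w (s ∷ e)) (∨-identityʳ (isEmpty? s))))
                       (sym (completions-⊥ w e)) ⟩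
        ∑ₗ (λ s → ⟦ not (isEmpty? s) ⟧ * completions w (s ∷ e)) L + completions w (⊥ ∷ e)
          ≡⟨ ∑ₗ-allSubsets-nonempty N (λ s → completions w (s ∷ e)) ⟩
        ∑ₗ (λ s → completions w (s ∷ e)) L ∎

  length-filter : ∀ {X : Set} {P : X → Set} (P? : Decidable P) (b : X → Bool) →
    (∀ x → P x ⇔ T (b x)) → ∀ xs → length (filter P? xs) ≡ ∑ₗ (⟦_⟧ ∘ b) xs
  length-filter P? b P⇔b [] = refl
  length-filter P? b P⇔b (x ∷ xs) with P? x | b x in bx
  ... | yes px | true  = cong suc (length-filter P? b P⇔b xs)
  ... | no  _  | false = length-filter P? b P⇔b xs
  ... | yes px | false = ⊥-elim (subst T bx (to (P⇔b x) px))
  ... | no ¬px | true  = ⊥-elim (¬px (from (P⇔b x) (subst T (sym bx) tt)))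

  module _ {n : ℕ} where

    ∈⇒lookup : ∀ {x : Fin n} {s} → x ∈ s → lookup s x ≡ true
    ∈⇒lookup = []=⇒lookup

    1≤multiplicity : ∀ (x : Fin n) F → Any (x ∈_) F → 1 ≤ multiplicity x F
    1≤multiplicity x (s ∷ F) (here x∈s) rewrite ∈⇒lookup x∈s = s≤s z≤n
    1≤multiplicity x (s ∷ F) (there x∈F) = ℕ.≤-trans (1≤multiplicity x F x∈F) (ℕ.m≤n+m _ ⟦ lookup s x ⟧)

    multiplicity≡1⇒Any : ∀ (x : Fin n) F → multiplicity x F ≡ 1 → Any (x ∈_) F
    multiplicity≡1⇒Any x (s ∷ F) m≡1 with lookup s x in x∈s
    ... | true  = here (lookup⇒[]= x s x∈s)
    ... | false = there (multiplicity≡1⇒Any x F m≡1)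

    multiplicity≤1 : ∀ F → AllPairs Disjoint F → ∀ (x : Fin n) → multiplicity x F ≤ 1
    multiplicity≤1 []      []          x = z≤n
    multiplicity≤1 (s ∷ F) (s#F ∷ #F) x with lookup s x in x∈s
    ... | false = multiplicity≤1 F #F x
    ... | true  = ℕ.≤-reflexive (cong suc (absent F s#F))
      where
      absent : ∀ F → All (Disjoint s) F → multiplicity x F ≡ 0
      absent []      []           = refl
      absent (t ∷ F) (s#t ∷ s#F) with lookup t x in x∈t
      ... | false = absent F s#F
      ... | true  = ⊥-elim (s#t (x , x∈p∩q⁺ (lookup⇒[]= x s x∈s , lookup⇒[]= x t x∈t)))

    multiplicity≤1⇒Disjoint : ∀ F → (∀ (x : Fin n) → multiplicity x F ≤ 1) → AllPairs Disjoint F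
    multiplicity≤1⇒Disjoint []      _    = []
    multiplicity≤1⇒Disjoint (s ∷ F) m≤1 =
      All.tabulate s#t ∷ multiplicity≤1⇒Disjoint F (λ x → ℕ.≤-trans (ℕ.m≤n+m (multiplicity x F) ⟦ lookup s x ⟧) (m≤1 x))
      where
      s#t : ∀ {t} → t ∈ₗ F → Disjoint s t
      s#t t∈F (y , y∈s∩t) with y∈s , y∈t ← x∈p∩q⁻ s _ y∈s∩t =
        ℕ.<⇒≱ (s≤s (1≤multiplicity y F (Any.map (λ { refl → y∈t }) t∈F)))
              (subst (λ b → ⟦ b ⟧ + multiplicity y F ≤ 1) (∈⇒lookup y∈s) (m≤1 y))

    partition⇔multiplicity≡1 : ∀ F → (AllPairs Disjoint F × (∀ (x : Fin n) → Any (x ∈_) F)) ⇔ (∀ x → multiplicity x F ≡ 1)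
    partition⇔multiplicity≡1 F = mk⇔
      (λ (#F , covers) x → ℕ.≤-antisym (multiplicity≤1 F #F x) (1≤multiplicity x F (covers x)))
      (λ m≡1 → multiplicity≤1⇒Disjoint F (ℕ.≤-reflexive ∘ m≡1) , (λ x → multiplicity≡1⇒Any x F (m≡1 x)))

  statusWord : (k d : ℕ) → Vec Status (suc (k + d))
  statusWord zero    d = singleton ∷ Vec.replicate d nonSingleton
  statusWord (suc k) d = free ∷ statusWord k d

  statusWord-< : ∀ {k d} (x : Fin (suc (k + d))) → toℕ x < k → lookup (statusWord k d) x ≡ free
  statusWord-< {suc k} zero    _         = refl
  statusWord-< {suc k} (suc x) (s≤s x<k) = statusWord-< x x<k

  statusWord-≡ : ∀ {k d} (x : Fin (suc (k + d))) → toℕ x ≡ k → lookup (statusWord k d) x ≡ singleton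
  statusWord-≡ {zero}  zero    _    = refl
  statusWord-≡ {suc k} (suc x) x≡k = statusWord-≡ x (ℕ.suc-injective x≡k)

  statusWord-> : ∀ {k d} (x : Fin (suc (k + d))) → k < toℕ x → lookup (statusWord k d) x ≡ nonSingleton
  statusWord-> {zero}  (suc x) _         = lookup-replicate x nonSingleton
  statusWord-> {suc k} (suc x) (s≤s k<x) = statusWord-> x k<x

  largestSingleton⇔statusWord : ∀ k d F → LargestSingletonIs F k ⇔ (∀ x → HasStatus (lookup (statusWord k d) x) x F)
  largestSingleton⇔statusWord k d F = mk⇔ to′ from′
    where
    hasStatus : ∀ {σ τ} x → σ ≡ τ → HasStatus τ x F → HasStatus σ x F
    hasStatus x σ≡τ = subst (λ τ → HasStatus τ x F) (sym σ≡τ)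
    to′ : LargestSingletonIs F k → ∀ x → HasStatus (lookup (statusWord k d) x) x F
    to′ ((y , y≡k , ⁅y⁆∈F) , above) x with ℕ.<-cmp (toℕ x) k
    ... | tri< x<k _ _ = hasStatus x (statusWord-< x x<k) tt
    ... | tri≈ _ x≡k _ = hasStatus x (statusWord-≡ x x≡k) (subst (λ z → ⁅ z ⁆ ∈ₗ F) (toℕ-injective (trans y≡k (sym x≡k))) ⁅y⁆∈F)
    ... | tri> _ _ k<x = hasStatus x (statusWord-> x k<x) (above x k<x)
    from′ : (∀ x → HasStatus (lookup (statusWord k d) x) x F) → LargestSingletonIs F k
    from′ statuses = (x₀ , toℕ-fromℕ< k<1+k+d , hasStatus x₀ (sym (statusWord-≡ x₀ (toℕ-fromℕ< k<1+k+d))) (statuses x₀))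
                   , (λ j k<j → hasStatus j (sym (statusWord-> j k<j)) (statuses j))
      where
      k<1+k+d : k < suc (k + d)
      k<1+k+d = s≤s (ℕ.m≤m+n k d)
      x₀ : Fin (suc (k + d))
      x₀ = fromℕ< k<1+k+d

  A≡partitionsWith : ∀ k d → A (k + d) k ≡ partitionsWith 0 (statusWord k d)
  A≡partitionsWith k d = trans
    (length-filter (λ F → isPartition? F ×-dec largestSingletonIs? F k) (admissible? w []) counted
                   (sublists (allSubsets (suc (k + d)))))
    (sym (ℕ.+-identityʳ _))
    where
    w = statusWord k d
    counted : ∀ F → (IsPartition F × LargestSingletonIs F k) ⇔ T (admissible? w [] F)
    counted F = mk⇔
      (λ ((ne , #F , covers) , largest) → admissible?-complete w [] F
         (ne , to (partition⇔multiplicity≡1 F) (#F , covers) , to (largestSingleton⇔statusWord k d F) largest))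
      (λ h → let (ne , mult , statuses) = admissible?-sound w [] F h
                 (#F , covers) = from (partition⇔multiplicity≡1 F) mult
             in (ne , #F , covers) , from (largestSingleton⇔statusWord k d F) statuses)


module PartitionSequences where

  open Sequences using (𝓜; 𝓜^; 𝓜-cong; U; W)
  open PartitionCount
  open import Data.Nat.Base as ℕ using (zero; suc)
  open import Data.Integer.Base using (+_; _+_; _*_; _-_)
  import Data.Integer.Properties as ℤ
  open import Data.Integer.Tactic.RingSolver using (solve-∀)
  open import Data.Vec.Base as Vec using ([]; _∷_)
  open import Defs using (A)
  open import Relation.Binary.PropositionalEquality

  ℕ-recurrence⇒𝓜 : ∀ (f : ℕ → ℕ) a → + (a ℕ.* f a ℕ.+ f (suc a)) ≡ 𝓜 (λ x → + f x) a
  ℕ-recurrence⇒𝓜 f a = begin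
    + (a ℕ.* f a ℕ.+ f (suc a))     ≡⟨ ℤ.pos-+ (a ℕ.* f a) (f (suc a)) ⟩
    + (a ℕ.* f a) + + f (suc a)     ≡⟨ cong (_+ + f (suc a)) (ℤ.pos-* a (f a)) ⟩
    + a * + f a + + f (suc a)       ≡⟨ ℤ.+-comm (+ a * + f a) (+ f (suc a)) ⟩
    𝓜 (λ x → + f x) a              ∎
    where open ≡-Reasoning

  +partitionsWith-nonSingletons : ∀ d a → + partitionsWith a (singleton ∷ Vec.replicate d nonSingleton) ≡ U d a
  +partitionsWith-nonSingletons zero    a = cong +_ (trans (partitionsWith-singleton [] a) (partitionsWith-[] a))
  +partitionsWith-nonSingletons (suc d) a = begin
    + partitionsWith a (singleton ∷ nonSingleton ∷ r)             ≡⟨ cong +_ (partitionsWith-singleton (nonSingleton ∷ r) a) ⟩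
    + partitionsWith a (nonSingleton ∷ r)                         ≡⟨ subtract (partitionsWith-nonSingleton r a) ⟩
    + (a ℕ.* P a ℕ.+ P (suc a)) - + P a                           ≡⟨ cong (_- + P a) (ℕ-recurrence⇒𝓜 P a) ⟩
    𝓜 (λ x → + P x) a - + P a                                    ≡⟨ cong₂ _-_ (𝓜-cong IH a) (IH a) ⟩
    U (suc d) a                                                   ∎
    where
    open ≡-Reasoning
    r = Vec.replicate d nonSingleton
    P : ℕ → ℕ
    P x = partitionsWith x r
    IH : ∀ x → + P x ≡ U d x
    IH x = trans (cong +_ (sym (partitionsWith-singleton r x))) (+partitionsWith-nonSingletons d x)
    subtract : ∀ {x y z} → x ℕ.+ y ≡ z → + x ≡ + z - + y
    subtract {x} {y} refl = trans (cancel (+ x) (+ y)) (cong (_- + y) (sym (ℤ.pos-+ x y)))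
      where cancel : ∀ a b → a ≡ (a + b) - b
            cancel = solve-∀

  +partitionsWith-statusWord : ∀ k d a → + partitionsWith a (statusWord k d) ≡ 𝓜^ k (U d) a
  +partitionsWith-statusWord zero    d a = +partitionsWith-nonSingletons d a
  +partitionsWith-statusWord (suc k) d a = begin
    + partitionsWith a (free ∷ statusWord k d)
      ≡⟨ cong +_ (partitionsWith-free (statusWord k d) a) ⟩
    + (a ℕ.* partitionsWith a (statusWord k d) ℕ.+ partitionsWith (suc a) (statusWord k d))
      ≡⟨ ℕ-recurrence⇒𝓜 (λ x → partitionsWith x (statusWord k d)) a ⟩
    𝓜 (λ x → + partitionsWith x (statusWord k d)) a
      ≡⟨ 𝓜-cong (+partitionsWith-statusWord k d) a ⟩
    𝓜^ (suc k) (U d) a ∎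
    where open ≡-Reasoning

  +A≡W : ∀ k d → + A (k ℕ.+ d) k ≡ W d k
  +A≡W k d = trans (cong +_ (A≡partitionsWith k d)) (+partitionsWith-statusWord k d 0)


open import Defs using (A)
open import Data.Nat.Base using (_+_; _*_)
open import Data.Integer.Base using (+_; _-_)
open import Data.Integer.Divisibility using (_∣_)
open import Data.Integer.Divisibility.Signed using (∣⇒∣ᵤ)
open import Relation.Binary.PropositionalEquality using (cong)
import Data.Nat.Properties as ℕ
open Sequences using (W)
open PartitionSequences using (+A≡W)

theorem4p1 : (p : ℕ) → Prime p → (n m k : ℕ) →
    (+ p) ∣ (+ A (n + p * m + k) k - + A (n + m + k) (m + k))
theorem4p1 p p-prime n m k = ∣⇒∣ᵤ (_≈_.p∣x-y (begin
  + A (n + p * m + k) k        ≡⟨ cong (λ N → + A N k) (ℕ.+-comm (n + p * m) k) ⟩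
  + A (k + (n + p * m)) k      ≡⟨ cong (λ d → + A (k + d) k) (ℕ.+-comm n (p * m)) ⟩
  + A (k + (p * m + n)) k      ≡⟨ +A≡W k (p * m + n) ⟩
  W (p * m + n) k              ≈⟨ W-periodicity m n k ⟩
  W n (m + k)                  ≡⟨ +A≡W (m + k) n ⟨
  + A (m + k + n) (m + k)      ≡⟨ cong (λ N → + A N (m + k)) (ℕ.+-comm (m + k) n) ⟩
  + A (n + (m + k)) (m + k)    ≡⟨ cong (λ N → + A N (m + k)) (ℕ.+-assoc n m k) ⟨
  + A (n + m + k) (m + k)      ∎))
  where
  open Congruence p using (_≈_; module ≈-Reasoning)
  open ModuloPrime p-prime using (W-periodicity)
  open ≈-Reasoning
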